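{- Let $G$ be a triangle-free $2$-connected graph with no induced subgraph isomorphic to a theta, a closed theta, or a wheel. Then $G$ has a Hamiltonian cycle.
   Context: Graphs are finite, without loops or parallel edges. A Hamiltonian cycle of $G$ is a (not necessarily induced) subgraph of $G$ which is a cycle containing every vertex of $G$. A graph is triangle-free if it contains no clique on three vertices. A theta is a graph consisting of two non-adjacent vertices $u,v$ (the ends) and three paths $P_1,P_2,P_3$ from $u$ to $v$, each of length at least two, such that the sets $V(P_i)\setminus\{u,v\}$ ($i=1,2,3$) are pairwise disjoint and there are no edges between any two of them (and no other edges). A closed theta is the graph obtained from a theta with ends $u,v$ by adding the edge $uv$. A wheel is the graph consisting of a cycle $W$ together with a vertex $v \notin V(W)$ having at least three neighbours in $W$, whose edges are the edges of $W$ and the edges from $v$ to its neighbours in $W$ (so $W$ is an induced cycle of the wheel). -}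

module Defs where

open import Data.Nat using (ℕ; zero; suc; _≤_)
open import Data.Fin using (Fin; toℕ; zero; suc)
open import Data.Bool using (Bool; true; false)
open import Data.Unit using (⊤)
open import Data.Product using (Σ; ∃; _×_; _,_)
open import Data.Sum using (_⊎_)
open import Relation.Nullary using (¬_)
open import Relation.Binary.PropositionalEquality using (_≡_; _≢_)

record Graph (n : ℕ) : Set where
  field
    adj    : Fin n → Fin n → Bool
    sym    : ∀ x y → adj x y ≡ adj y x
    irrefl : ∀ x → adj x x ≡ false

open Graph public

Adj : ∀ {n} → Graph n → Fin n → Fin n → Set
Adj G x y = adj G x y ≡ true

TriangleFree : ∀ {n} → Graph n → Set
TriangleFree G = ¬ (∃ λ x → ∃ λ y → ∃ λ z → Adj G x y × Adj G y z × Adj G x z)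

data Walk {n} (G : Graph n) (P : Fin n → Set) : Fin n → Fin n → Set where
  []  : ∀ {x} → P x → Walk G P x x
  _∷_ : ∀ {x y z} → (P x × Adj G x y) → Walk G P y z → Walk G P x z

Connected : ∀ {n} → Graph n → Set
Connected G = ∀ x y → Walk G (λ _ → ⊤) x y

ConnectedWithout : ∀ {n} → Graph n → Fin n → Set
ConnectedWithout G v = ∀ x y → x ≢ v → y ≢ v → Walk G (λ w → w ≢ v) x y

TwoConnected : ∀ {n} → Graph n → Set
TwoConnected {n} G = 3 ≤ n × Connected G × (∀ v → ConnectedWithout G v)

HasInduced : ∀ {n} → Graph n → (V : Set) → (V → V → Set) → Set
HasInduced {n} G V A =
  Σ (V → Fin n) λ f →
    (∀ i j → f i ≡ f j → i ≡ j) ×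
    (∀ i j → (A i j → Adj G (f i) (f j)) × (Adj G (f i) (f j) → A i j))

SymClo : ∀ {V : Set} → (V → V → Set) → V → V → Set
SymClo D x y = D x y ⊎ D y x

CycSucc : ∀ {m} → Fin m → Fin m → Set
CycSucc {m} i j = (toℕ j ≡ suc (toℕ i)) ⊎ (suc (toℕ i) ≡ m × toℕ j ≡ 0)

-- Thetas.  ℓ k + 1 is the number of interior vertices of path P_k
-- (so P_k has length ℓ k + 2 ≥ 2).

data ThetaV (ℓ : Fin 3 → ℕ) : Set where
  U V : ThetaV ℓ
  P   : (k : Fin 3) → Fin (suc (ℓ k)) → ThetaV ℓ

data ThetaD (ℓ : Fin 3 → ℕ) : ThetaV ℓ → ThetaV ℓ → Set where
  first : ∀ k → ThetaD ℓ U (P k zero)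
  along : ∀ k (i j : Fin (suc (ℓ k))) → toℕ j ≡ suc (toℕ i) → ThetaD ℓ (P k i) (P k j)
  last  : ∀ k (i : Fin (suc (ℓ k))) → toℕ i ≡ ℓ k → ThetaD ℓ (P k i) V

ThetaAdj : (ℓ : Fin 3 → ℕ) → ThetaV ℓ → ThetaV ℓ → Set
ThetaAdj ℓ = SymClo (ThetaD ℓ)

data ClosedThetaD (ℓ : Fin 3 → ℕ) : ThetaV ℓ → ThetaV ℓ → Set where
  theta : ∀ {x y} → ThetaD ℓ x y → ClosedThetaD ℓ x y
  uv    : ClosedThetaD ℓ U V

ClosedThetaAdj : (ℓ : Fin 3 → ℕ) → ThetaV ℓ → ThetaV ℓ → Set
ClosedThetaAdj ℓ = SymClo (ClosedThetaD ℓ)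

HasInducedTheta : ∀ {n} → Graph n → Set
HasInducedTheta G = ∃ λ ℓ → HasInduced G (ThetaV ℓ) (ThetaAdj ℓ)

HasInducedClosedTheta : ∀ {n} → Graph n → Set
HasInducedClosedTheta G = ∃ λ ℓ → HasInduced G (ThetaV ℓ) (ClosedThetaAdj ℓ)

data WheelV (m : ℕ) : Set where
  hub : WheelV m
  rim : Fin m → WheelV m

data WheelD (m : ℕ) (S : Fin m → Bool) : WheelV m → WheelV m → Set where
  cyc   : ∀ i j → CycSucc i j → WheelD m S (rim i) (rim j)
  spoke : ∀ i → S i ≡ true → WheelD m S hub (rim i)

WheelAdj : (m : ℕ) → (Fin m → Bool) → WheelV m → WheelV m → Set
WheelAdj m S = SymClo (WheelD m S)

AtLeastThree : ∀ {m} → (Fin m → Bool) → Set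
AtLeastThree S = ∃ λ i → ∃ λ j → ∃ λ k →
  i ≢ j × j ≢ k × i ≢ k × S i ≡ true × S j ≡ true × S k ≡ true

HasInducedWheel : ∀ {n} → Graph n → Set
HasInducedWheel G = ∃ λ m → 3 ≤ m × Σ (Fin m → Bool) λ S →
  AtLeastThree S × HasInduced G (WheelV m) (WheelAdj m S)

Hamiltonian : ∀ {n} → Graph n → Set
Hamiltonian {n} G = 3 ≤ n × Σ (Fin n → Fin n) λ σ →
  (∀ i j → σ i ≡ σ j → i ≡ j) ×
  (∀ v → ∃ λ i → σ i ≡ v) ×
  (∀ i j → CycSucc i j → Adj G (σ i) (σ j))

-- Call three internally disjoint u–v paths, each with an interior vertex, a theta subgraph (edges among
-- their vertices are not restricted), and take one with the fewest interior vertices.  Minimality rules out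
-- every chord except one kind: from the only interior vertex x of one path to an inner vertex y of another.
-- As the graph is triangle-free, without such chords the subgraph is an induced theta, or an induced closed
-- theta when u ~ v; with one, x is the hub of an induced wheel whose rim is the cycle formed by the other two
-- paths.  So the graph has no theta subgraph at all.
-- Now grow a cycle.  By 2-connectivity any vertex off the cycle lies on an ear: a path outside the cycle
-- between two distinct cycle vertices s and t.  If s and t were not consecutive on the cycle, the two arcs
-- between them and the ear would form a theta subgraph; so the ear can be inserted between them, and the
-- cycle grows until it is Hamiltonian.
module Submission where

open import Data.Bool as Bool using (Bool; true)
open import Data.Empty using (⊥; ⊥-elim)
open import Data.Fin as F using (Fin; toℕ)
open import Data.Fin.Patterns using (0F; 1F; 2F)
open import Data.Fin.Properties using (injective⇒≤; any?; toℕ-cast; cast-involutive; toℕ-injective)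
open import Data.List using (List; []; _∷_; _++_; reverse; length; lookup)
open import Data.List.Properties
  using (++-assoc; length-++; length-reverse; unfold-reverse; reverse-++; reverse-involutive; ∷-injectiveʳ)
open import Data.List.Membership.Propositional using (_∈_; _∉_)
open import Data.List.Membership.Propositional.Properties
  using (∈-∃++; ∈-++⁺ˡ; ∈-++⁺ʳ; ∈-++⁻; ∈-lookup)
open import Data.List.Relation.Unary.Any using (here; there; index)
open import Data.List.Relation.Unary.Any.Properties using (lookup-index; reverse⁻)
open import Data.Nat using (ℕ; suc; _+_; _∸_; _≤_; _<_; z≤n; s≤s)
open import Data.Nat.Properties
open import Data.Nat.Tactic.RingSolver using (solve-∀)
open import Data.Product using (∃; ∃₂; _×_; _,_; proj₁; proj₂)
open import Data.Sum using (_⊎_; inj₁; inj₂; [_,_]′)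
open import Relation.Binary.Definitions using (DecidableEquality)
open import Relation.Binary.PropositionalEquality
open import Relation.Nullary using (¬_; yes; no)
open import Relation.Nullary.Decidable using (¬?; decidable-stable)
open import Defs hiding (sym)

++-∷≢[] : ∀ {A : Set} (xs : List A) {x ys} → xs ++ x ∷ ys ≢ []
++-∷≢[] [] ()
++-∷≢[] (_ ∷ _) ()

≢[]⇒0<length : ∀ {A : Set} {xs : List A} → xs ≢ [] → 0 < length xs
≢[]⇒0<length {xs = []} xs≢[] = ⊥-elim (xs≢[] refl)
≢[]⇒0<length {xs = _ ∷ _} _ = s≤s z≤n

reverse≢[] : ∀ {A : Set} (xs : List A) → xs ≢ [] → reverse xs ≢ []
reverse≢[] xs xs≢[] rev≡[] = xs≢[] (trans (sym (reverse-involutive xs)) (cong reverse rev≡[]))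

length-++ˡ-< : ∀ {A : Set} (xs : List A) {ys zs : List A} →
  length ys < length zs → length (xs ++ ys) < length (xs ++ zs)
length-++ˡ-< xs {ys} {zs} ys<zs = begin-strict
  length (xs ++ ys)        ≡⟨ length-++ xs ⟩
  length xs + length ys    <⟨ +-monoʳ-< (length xs) ys<zs ⟩
  length xs + length zs    ≡⟨ sym (length-++ xs) ⟩
  length (xs ++ zs)        ∎
  where open ≤-Reasoning

length-++ʳ-< : ∀ {A : Set} {xs : List A} ys → xs ≢ [] → length ys < length (xs ++ ys)
length-++ʳ-< {xs = xs} ys xs≢[] =
  subst (length ys <_) (sym (length-++ xs)) (m<n+m (length ys) (≢[]⇒0<length xs≢[]))

Consecutive : ∀ {A : Set} → A → A → List A → Set
Consecutive s t xs = ∃₂ λ as bs → xs ≡ as ++ s ∷ t ∷ bs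

consecutive-++ˡ : ∀ {A : Set} {s t : A} xs {ys} → Consecutive s t ys → Consecutive s t (xs ++ ys)
consecutive-++ˡ xs (as , bs , refl) = xs ++ as , bs , sym (++-assoc xs as _)

consecutive-++ʳ : ∀ {A : Set} {s t : A} {xs} ys → Consecutive s t xs → Consecutive s t (xs ++ ys)
consecutive-++ʳ ys (as , bs , refl) = as , bs ++ ys , ++-assoc as _ ys

consecutive-reverse : ∀ {A : Set} {s t : A} {xs} → Consecutive s t xs → Consecutive t s (reverse xs)
consecutive-reverse {s = s} {t} (as , bs , refl) = reverse bs , reverse as , (begin
  reverse (as ++ s ∷ t ∷ bs)
    ≡⟨ reverse-++ as (s ∷ t ∷ bs) ⟩
  reverse (s ∷ t ∷ bs) ++ reverse as
    ≡⟨ cong (_++ reverse as) (unfold-reverse s (t ∷ bs)) ⟩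
  (reverse (t ∷ bs) ++ s ∷ []) ++ reverse as
    ≡⟨ cong (λ l → (l ++ s ∷ []) ++ reverse as) (unfold-reverse t bs) ⟩
  ((reverse bs ++ t ∷ []) ++ s ∷ []) ++ reverse as
    ≡⟨ ++-assoc (reverse bs ++ t ∷ []) (s ∷ []) (reverse as) ⟩
  (reverse bs ++ t ∷ []) ++ s ∷ reverse as
    ≡⟨ ++-assoc (reverse bs) (t ∷ []) (s ∷ reverse as) ⟩
  reverse bs ++ t ∷ s ∷ reverse as ∎)
  where open ≡-Reasoning

∈-ordered : ∀ {A : Set} {s t : A} xs → s ∈ xs → t ∈ xs → s ≢ t →
  (∃₂ λ as ms → ∃ λ bs → xs ≡ as ++ s ∷ ms ++ t ∷ bs) ⊎
  (∃₂ λ as ms → ∃ λ bs → xs ≡ as ++ t ∷ ms ++ s ∷ bs)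
∈-ordered (x ∷ xs) (here refl) (here refl) s≢t = ⊥-elim (s≢t refl)
∈-ordered (x ∷ xs) (here refl) (there t∈xs) _ with ∈-∃++ t∈xs
... | ms , bs , refl = inj₁ ([] , ms , bs , refl)
∈-ordered (x ∷ xs) (there s∈xs) (here refl) _ with ∈-∃++ s∈xs
... | ms , bs , refl = inj₂ ([] , ms , bs , refl)
∈-ordered (x ∷ xs) (there s∈xs) (there t∈xs) s≢t with ∈-ordered xs s∈xs t∈xs s≢t
... | inj₁ (as , ms , bs , refl) = inj₁ (x ∷ as , ms , bs , refl)
... | inj₂ (as , ms , bs , refl) = inj₂ (x ∷ as , ms , bs , refl)

-- t follows s on the cycle traced by xs (the last element of xs is followed by the first).
CyclicallyConsecutive : ∀ {A : Set} → A → A → List A → Set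
CyclicallyConsecutive s t xs = Consecutive s t xs ⊎ ∃ λ as → xs ≡ t ∷ as ++ s ∷ []

module DistinctLists {A : Set} (_≟_ : DecidableEquality A) where

  open import Data.List.Membership.DecPropositional _≟_ public using (_∈?_)

  δ : A → A → ℕ
  δ z x with z ≟ x
  ... | yes _ = 1
  ... | no _ = 0

  δ-refl : ∀ z → δ z z ≡ 1
  δ-refl z with z ≟ z
  ... | yes _ = refl
  ... | no z≢z = ⊥-elim (z≢z refl)

  multiplicity : A → List A → ℕ
  multiplicity z [] = 0
  multiplicity z (x ∷ xs) = δ z x + multiplicity z xs

  multiplicity-++ : ∀ z xs ys → multiplicity z (xs ++ ys) ≡ multiplicity z xs + multiplicity z ys
  multiplicity-++ z [] ys = refl
  multiplicity-++ z (x ∷ xs) ys =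
    trans (cong (δ z x +_) (multiplicity-++ z xs ys)) (sym (+-assoc (δ z x) _ _))

  multiplicity-reverse : ∀ z xs → multiplicity z (reverse xs) ≡ multiplicity z xs
  multiplicity-reverse z [] = refl
  multiplicity-reverse z (x ∷ xs) = begin
    multiplicity z (reverse (x ∷ xs))
      ≡⟨ cong (multiplicity z) (unfold-reverse x xs) ⟩
    multiplicity z (reverse xs ++ x ∷ [])
      ≡⟨ multiplicity-++ z (reverse xs) (x ∷ []) ⟩
    multiplicity z (reverse xs) + (δ z x + 0)
      ≡⟨ cong₂ _+_ (multiplicity-reverse z xs) (+-identityʳ (δ z x)) ⟩
    multiplicity z xs + δ z x
      ≡⟨ +-comm (multiplicity z xs) (δ z x) ⟩
    multiplicity z (x ∷ xs) ∎
    where open ≡-Reasoning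

  infix 4 _⊑_
  record _⊑_ (xs ys : List A) : Set where
    constructor multiplicity-≤
    field ⊑⇒≤ : ∀ z → multiplicity z xs ≤ multiplicity z ys
  open _⊑_ public

  []⊑ : ∀ ys → [] ⊑ ys
  []⊑ _ = multiplicity-≤ λ _ → z≤n

  ⊑-∷⁺ : ∀ x {xs ys} → xs ⊑ ys → x ∷ xs ⊑ x ∷ ys
  ⊑-∷⁺ x xs⊑ys = multiplicity-≤ λ z → +-monoʳ-≤ (δ z x) (⊑⇒≤ xs⊑ys z)

  ⊑-++⁺ˡ : ∀ as {xs ys} → xs ⊑ ys → as ++ xs ⊑ as ++ ys
  ⊑-++⁺ˡ [] xs⊑ys = xs⊑ys
  ⊑-++⁺ˡ (a ∷ as) xs⊑ys = ⊑-∷⁺ a (⊑-++⁺ˡ as xs⊑ys)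

  ⊑-++ʳ : ∀ as {xs} → xs ⊑ as ++ xs
  ⊑-++ʳ as {xs} = multiplicity-≤ λ z →
    subst (multiplicity z xs ≤_) (sym (multiplicity-++ z as xs)) (m≤n+m _ _)

  ∈⇒1≤multiplicity : ∀ {z xs} → z ∈ xs → 1 ≤ multiplicity z xs
  ∈⇒1≤multiplicity {z} {_ ∷ xs} (here refl) =
    subst (1 ≤_) (sym (cong (_+ multiplicity z xs) (δ-refl z))) (s≤s z≤n)
  ∈⇒1≤multiplicity {z} {x ∷ xs} (there z∈xs) =
    ≤-trans (∈⇒1≤multiplicity z∈xs) (m≤n+m (multiplicity z xs) (δ z x))

  ∉⇒multiplicity≡0 : ∀ {z xs} → z ∉ xs → multiplicity z xs ≡ 0
  ∉⇒multiplicity≡0 {xs = []} _ = refl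
  ∉⇒multiplicity≡0 {z} {x ∷ xs} z∉ with z ≟ x
  ... | yes refl = ⊥-elim (z∉ (here refl))
  ... | no _ = ∉⇒multiplicity≡0 (λ z∈xs → z∉ (there z∈xs))

  ∈-both⇒multiplicities≰1 : ∀ {z xs ys} → z ∈ xs → z ∈ ys →
    ¬ multiplicity z xs + multiplicity z ys ≤ 1
  ∈-both⇒multiplicities≰1 z∈xs z∈ys bound with ∈⇒1≤multiplicity z∈xs | ∈⇒1≤multiplicity z∈ys
  ... | p | q = 1+n≰n (≤-trans (+-mono-≤ p q) bound)

  Distinct : List A → Set
  Distinct xs = ∀ z → multiplicity z xs ≤ 1

  Distinct-[] : Distinct []
  Distinct-[] _ = z≤n

  Distinct-∷ : ∀ {x xs} → x ∉ xs → Distinct xs → Distinct (x ∷ xs)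
  Distinct-∷ {x} x∉xs dxs z with z ≟ x
  ... | yes refl = ≤-reflexive (cong suc (∉⇒multiplicity≡0 x∉xs))
  ... | no _ = dxs z

  Distinct-tail : ∀ {x xs} → Distinct (x ∷ xs) → Distinct xs
  Distinct-tail {x} {xs} d z = ≤-trans (m≤n+m (multiplicity z xs) (δ z x)) (d z)

  Distinct-head : ∀ {x xs} → Distinct (x ∷ xs) → x ∉ xs
  Distinct-head {x} {xs} d x∈xs =
    1+n≰n (≤-trans (+-mono-≤ (≤-reflexive (sym (δ-refl x))) (∈⇒1≤multiplicity x∈xs)) (d x))

  Distinct-++⁺ : ∀ {xs ys} → Distinct xs → Distinct ys → (∀ {z} → z ∈ ys → z ∉ xs) →
    Distinct (xs ++ ys)
  Distinct-++⁺ {xs} {ys} dxs dys disjoint z rewrite multiplicity-++ z xs ys with z ∈? ys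
  ... | yes z∈ys rewrite ∉⇒multiplicity≡0 (disjoint z∈ys) = dys z
  ... | no z∉ys rewrite ∉⇒multiplicity≡0 z∉ys = subst (_≤ 1) (sym (+-identityʳ _)) (dxs z)

  Distinct-or-repeated : ∀ xs →
    Distinct xs ⊎ ∃₂ λ as z → ∃₂ λ ms bs → xs ≡ as ++ z ∷ ms ++ z ∷ bs
  Distinct-or-repeated [] = inj₁ Distinct-[]
  Distinct-or-repeated (x ∷ xs) with x ∈? xs
  ... | yes x∈xs with ∈-∃++ x∈xs
  ...   | ms , bs , refl = inj₂ ([] , x , ms , bs , refl)
  Distinct-or-repeated (x ∷ xs) | no x∉xs with Distinct-or-repeated xs
  ... | inj₁ d = inj₁ (Distinct-∷ x∉xs d)
  ... | inj₂ (as , z , ms , bs , refl) = inj₂ (x ∷ as , z , ms , bs , refl)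

  lookup-injective : ∀ xs → Distinct xs → ∀ i j → lookup xs i ≡ lookup xs j → i ≡ j
  lookup-injective (x ∷ xs) d F.zero F.zero _ = refl
  lookup-injective (x ∷ xs) d F.zero (F.suc j) eq =
    ⊥-elim (Distinct-head d (subst (_∈ xs) (sym eq) (∈-lookup j)))
  lookup-injective (x ∷ xs) d (F.suc i) F.zero eq =
    ⊥-elim (Distinct-head d (subst (_∈ xs) eq (∈-lookup i)))
  lookup-injective (x ∷ xs) d (F.suc i) (F.suc j) eq =
    cong F.suc (lookup-injective xs (Distinct-tail {x} {xs} d) i j eq)

  lookup-position : ∀ {xs} as {a} bs → xs ≡ as ++ a ∷ bs → Distinct xs →
    ∀ i → lookup xs i ≡ a → toℕ i ≡ length as
  lookup-position [] bs refl d F.zero _ = refl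
  lookup-position [] bs refl d (F.suc i) eq =
    ⊥-elim (Distinct-head d (subst (_∈ bs) eq (∈-lookup i)))
  lookup-position (x ∷ as) {a} bs refl d F.zero eq =
    ⊥-elim (Distinct-head d (subst (_∈ as ++ a ∷ bs) (sym eq) (∈-++⁺ʳ as (here refl))))
  lookup-position (x ∷ as) bs refl d (F.suc i) eq =
    cong suc (lookup-position as bs refl (Distinct-tail {x} {as ++ _ ∷ _} d) i eq)

  consecutive-positions : ∀ xs → Distinct xs → ∀ i j → Consecutive (lookup xs i) (lookup xs j) xs →
    toℕ j ≡ suc (toℕ i)
  consecutive-positions xs d i j (as , bs , eq) = begin
    toℕ j
      ≡⟨ lookup-position (as ++ lookup xs i ∷ []) bs (trans eq (sym (++-assoc as _ _))) d j refl ⟩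
    length (as ++ _ ∷ [])      ≡⟨ length-++ as ⟩
    length as + 1              ≡⟨ +-comm (length as) 1 ⟩
    suc (length as)            ≡⟨ cong suc (sym (lookup-position as _ eq d i refl)) ⟩
    suc (toℕ i)                ∎
    where open ≡-Reasoning

  cyclically-consecutive-positions : ∀ xs → Distinct xs → ∀ i j →
    CyclicallyConsecutive (lookup xs i) (lookup xs j) xs → CycSucc i j
  cyclically-consecutive-positions xs d i j (inj₁ consecutive) = inj₁ (consecutive-positions xs d i j consecutive)
  cyclically-consecutive-positions xs d i j (inj₂ (as , eq)) = inj₂ (i-last , lookup-position [] _ eq d j refl)
    where
    i-last : suc (toℕ i) ≡ length xs
    i-last = begin
      suc (toℕ i)                    ≡⟨ cong suc (lookup-position (lookup xs j ∷ as) [] eq d i refl) ⟩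
      suc (suc (length as))          ≡⟨ cong suc (+-comm 1 (length as)) ⟩
      suc (length as + 1)            ≡⟨ cong suc (sym (length-++ as)) ⟩
      length (lookup xs j ∷ as ++ lookup xs i ∷ [])  ≡⟨ cong length (sym eq) ⟩
      length xs                      ∎
      where open ≡-Reasoning

open module DistinctVertices {n} = DistinctLists (F._≟_ {n})

module _ {n : ℕ} (G : Graph n) where

  Adj-sym : ∀ {x y} → Adj G x y → Adj G y x
  Adj-sym {x} {y} = trans (Graph.sym G y x)

  Adj-irrefl : ∀ {x} → ¬ Adj G x x
  Adj-irrefl {x} x~x with trans (sym (Graph.irrefl G x)) x~x
  ... | ()

  triangle : TriangleFree G → ∀ {a b c} → Adj G a b → Adj G b c → Adj G a c → ⊥
  triangle triangle-free {a} {b} {c} a~b b~c a~c = triangle-free (a , b , c , a~b , b~c , a~c)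

  Chain : Fin n → List (Fin n) → Fin n → Set
  Chain a [] b = Adj G a b
  Chain a (x ∷ xs) b = Adj G a x × Chain x xs b

  chain-++⁻ : ∀ {a x b} xs {ys} → Chain a (xs ++ x ∷ ys) b → Chain a xs x × Chain x ys b
  chain-++⁻ [] (a~x , c) = a~x , c
  chain-++⁻ (y ∷ xs) (a~y , c) = (a~y , proj₁ (chain-++⁻ xs c)) , proj₂ (chain-++⁻ xs c)

  chain-++⁺ : ∀ {a x b} xs {ys} → Chain a xs x → Chain x ys b → Chain a (xs ++ x ∷ ys) b
  chain-++⁺ [] a~x c = a~x , c
  chain-++⁺ (y ∷ xs) (a~y , c) c' = a~y , chain-++⁺ xs c c'

  chain-reverse : ∀ {a b} xs → Chain a xs b → Chain b (reverse xs) a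
  chain-reverse [] a~b = Adj-sym a~b
  chain-reverse (x ∷ xs) (a~x , c) rewrite unfold-reverse x xs =
    chain-++⁺ (reverse xs) (chain-reverse xs c) (Adj-sym a~x)

  chain-step : ∀ {a b} xs → Chain a xs b → ∀ i j → toℕ j ≡ suc (toℕ i) →
    Adj G (lookup (a ∷ xs) i) (lookup (a ∷ xs) j)
  chain-step (x ∷ xs) (a~x , _) F.zero (F.suc F.zero) _ = a~x
  chain-step (x ∷ xs) (_ , c) (F.suc i) (F.suc j) eq = chain-step xs c i j (suc-injective eq)
  chain-step [] _ F.zero F.zero ()
  chain-step (x ∷ xs) _ F.zero F.zero ()
  chain-step (x ∷ xs) _ F.zero (F.suc (F.suc j)) ()
  chain-step (x ∷ xs) _ (F.suc i) F.zero ()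

  chain-last : ∀ {a b} xs → Chain a xs b → ∀ i → toℕ i ≡ length xs → Adj G (lookup (a ∷ xs) i) b
  chain-last [] a~b F.zero _ = a~b
  chain-last (x ∷ xs) (_ , c) (F.suc i) eq = chain-last xs c i (suc-injective eq)
  chain-last (x ∷ xs) _ F.zero ()

  closed-chain-cyclic : ∀ {a} xs → Chain a xs a → ∀ i j → CycSucc i j →
    Adj G (lookup (a ∷ xs) i) (lookup (a ∷ xs) j)
  closed-chain-cyclic xs c i j (inj₁ j≡1+i) = chain-step xs c i j j≡1+i
  closed-chain-cyclic xs c i F.zero (inj₂ (1+i≡len , _)) = chain-last xs c i (suc-injective 1+i≡len)

  walk-first-edge : ∀ {P a b} → Walk G P a b → a ≢ b → ∃ λ y → Adj G a y
  walk-first-edge ([] _) a≢a = ⊥-elim (a≢a refl)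
  walk-first-edge ((_ , a~y) ∷ _) _ = _ , a~y

  first-entry : ∀ {P a z} (S : List (Fin n)) → Walk G P a z → z ∈ S → a ∉ S →
    ∃₂ λ s xs → Chain a xs s × s ∈ S × P s × (∀ {q} → q ∈ xs → q ∉ S)
  first-entry S ([] _) z∈S a∉S = ⊥-elim (a∉S z∈S)
  first-entry S (_∷_ {y = y} (_ , a~y) w) z∈S a∉S with y ∈? S
  ... | yes y∈S = y , [] , a~y , y∈S , walk-head w , λ ()
    where
    walk-head : ∀ {P b c} → Walk G P b c → P b
    walk-head ([] p) = p
    walk-head ((p , _) ∷ _) = p
  ... | no y∉S with first-entry S w z∈S y∉S
  ... | s , xs , c , s∈S , Ps , avoid =
    s , y ∷ xs , (a~y , c) , s∈S , Ps , λ { (here refl) → y∉S ; (there q∈xs) → avoid q∈xs }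

  -- Cutting out the closed sub-walk between two occurrences of a repeated vertex.
  distinct-chain : ∀ {a b} xs → Chain a xs b → xs ≢ [] →
    ∃ λ ys → Distinct ys × Chain a ys b × ys ≢ [] × (∀ {q} → q ∈ ys → q ∈ xs)
  distinct-chain xs = go (suc (length xs)) xs ≤-refl
    where
    go : ∀ {a b} m xs → length xs < m → Chain a xs b → xs ≢ [] →
      ∃ λ ys → Distinct ys × Chain a ys b × ys ≢ [] × (∀ {q} → q ∈ ys → q ∈ xs)
    go (suc m) xs (s≤s len≤m) c xs≢[] with Distinct-or-repeated xs
    ... | inj₁ d = xs , d , c , xs≢[] , λ q∈xs → q∈xs
    ... | inj₂ (as , z , ms , bs , refl)
      with go m (as ++ z ∷ bs) shorter
              (chain-++⁺ as (proj₁ c₁) (proj₂ (chain-++⁻ ms (proj₂ c₁)))) (++-∷≢[] as)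
      where
      c₁ = chain-++⁻ as c
      shorter : length (as ++ z ∷ bs) < m
      shorter = <-≤-trans (length-++ˡ-< as (length-++ʳ-< {xs = z ∷ ms} (z ∷ bs) (λ ()))) len≤m
    ... | ys , d , c' , ys≢[] , ys⊆ = ys , d , c' , ys≢[] , λ q∈ys → cut⊆ (ys⊆ q∈ys)
      where
      cut⊆ : ∀ {q} → q ∈ as ++ z ∷ bs → q ∈ as ++ z ∷ ms ++ z ∷ bs
      cut⊆ q∈ with ∈-++⁻ as q∈
      ... | inj₁ q∈as = ∈-++⁺ˡ q∈as
      ... | inj₂ (here refl) = ∈-++⁺ʳ as (here refl)
      ... | inj₂ (there q∈bs) = ∈-++⁺ʳ as (there (∈-++⁺ʳ ms (there q∈bs)))

∑₃ : (Fin 3 → ℕ) → ℕ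
∑₃ f = f 0F + f 1F + f 2F

another : (k : Fin 3) → ∃ λ k' → k ≢ k'
another 0F = 1F , λ ()
another (F.suc _) = 0F , λ ()

third : ∀ {k k' : Fin 3} → k ≢ k' → ∃ λ c → k ≢ c × k' ≢ c
third {0F} {0F} k≢k' = ⊥-elim (k≢k' refl)
third {0F} {1F} _ = 2F , (λ ()) , (λ ())
third {0F} {2F} _ = 1F , (λ ()) , (λ ())
third {1F} {0F} _ = 2F , (λ ()) , (λ ())
third {1F} {1F} k≢k' = ⊥-elim (k≢k' refl)
third {1F} {2F} _ = 0F , (λ ()) , (λ ())
third {2F} {0F} _ = 1F , (λ ()) , (λ ())
third {2F} {1F} _ = 0F , (λ ()) , (λ ())
third {2F} {2F} k≢k' = ⊥-elim (k≢k' refl)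

∑₃-permute : ∀ f {k k' c} → k ≢ k' → k ≢ c → k' ≢ c → f k + f k' + f c ≡ ∑₃ f
∑₃-permute f {0F} {1F} {2F} _ _ _ = refl
∑₃-permute f {0F} {2F} {1F} _ _ _ = swap₂₃ (f 0F) (f 1F) (f 2F)
  where swap₂₃ : ∀ a b c → a + c + b ≡ a + b + c
        swap₂₃ = solve-∀
∑₃-permute f {1F} {0F} {2F} _ _ _ = swap₁₂ (f 0F) (f 1F) (f 2F)
  where swap₁₂ : ∀ a b c → b + a + c ≡ a + b + c
        swap₁₂ = solve-∀
∑₃-permute f {1F} {2F} {0F} _ _ _ = rotate (f 0F) (f 1F) (f 2F)
  where rotate : ∀ a b c → b + c + a ≡ a + b + c
        rotate = solve-∀
∑₃-permute f {2F} {0F} {1F} _ _ _ = rotate (f 0F) (f 1F) (f 2F)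
  where rotate : ∀ a b c → c + a + b ≡ a + b + c
        rotate = solve-∀
∑₃-permute f {2F} {1F} {0F} _ _ _ = swap₁₃ (f 0F) (f 1F) (f 2F)
  where swap₁₃ : ∀ a b c → c + b + a ≡ a + b + c
        swap₁₃ = solve-∀
∑₃-permute f {0F} {0F} k≢k' _ _ = ⊥-elim (k≢k' refl)
∑₃-permute f {1F} {1F} k≢k' _ _ = ⊥-elim (k≢k' refl)
∑₃-permute f {2F} {2F} k≢k' _ _ = ⊥-elim (k≢k' refl)
∑₃-permute f {0F} {1F} {0F} _ k≢c _ = ⊥-elim (k≢c refl)
∑₃-permute f {0F} {1F} {1F} _ _ k'≢c = ⊥-elim (k'≢c refl)
∑₃-permute f {0F} {2F} {0F} _ k≢c _ = ⊥-elim (k≢c refl)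
∑₃-permute f {0F} {2F} {2F} _ _ k'≢c = ⊥-elim (k'≢c refl)
∑₃-permute f {1F} {0F} {0F} _ _ k'≢c = ⊥-elim (k'≢c refl)
∑₃-permute f {1F} {0F} {1F} _ k≢c _ = ⊥-elim (k≢c refl)
∑₃-permute f {1F} {2F} {1F} _ k≢c _ = ⊥-elim (k≢c refl)
∑₃-permute f {1F} {2F} {2F} _ _ k'≢c = ⊥-elim (k'≢c refl)
∑₃-permute f {2F} {0F} {0F} _ _ k'≢c = ⊥-elim (k'≢c refl)
∑₃-permute f {2F} {0F} {2F} _ k≢c _ = ⊥-elim (k≢c refl)
∑₃-permute f {2F} {1F} {1F} _ _ k'≢c = ⊥-elim (k'≢c refl)
∑₃-permute f {2F} {1F} {2F} _ k≢c _ = ⊥-elim (k≢c refl)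

∑₃-≥ : ∀ f k → f k ≤ ∑₃ f
∑₃-≥ f 0F = ≤-trans (m≤m+n (f 0F) (f 1F)) (m≤m+n _ (f 2F))
∑₃-≥ f 1F = ≤-trans (m≤n+m (f 1F) (f 0F)) (m≤m+n _ (f 2F))
∑₃-≥ f 2F = m≤n+m (f 2F) _

∑₃-≥₂ : ∀ f {k k'} → k ≢ k' → f k + f k' ≤ ∑₃ f
∑₃-≥₂ f {k} {k'} k≢k' with third k≢k'
... | c , k≢c , k'≢c = subst (f k + f k' ≤_) (∑₃-permute f k≢k' k≢c k'≢c) (m≤m+n _ (f c))

module _ {n : ℕ} (G : Graph n) where

  -- `distinct` says that u, v and all interior vertices are pairwise distinct.
  record ThetaSubgraph : Set where
    field
      u v : Fin n
      interior : Fin 3 → List (Fin n)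
      interior≢[] : ∀ k → interior k ≢ []
      chain : ∀ k → Chain G u (interior k) v
      distinct : ∀ z → δ z u + δ z v + ∑₃ (λ k → multiplicity z (interior k)) ≤ 1

  size : ThetaSubgraph → ℕ
  size T = ∑₃ (λ k → length (ThetaSubgraph.interior T k))

  Shorter : ThetaSubgraph → Set
  Shorter T = ∃ λ T' → size T' < size T

  theta₃ : ∀ {u v} ps qs rs → ps ≢ [] → qs ≢ [] → rs ≢ [] →
    Chain G u ps v → Chain G u qs v → Chain G u rs v →
    (∀ z → δ z u + δ z v + (multiplicity z ps + multiplicity z qs + multiplicity z rs) ≤ 1) → ThetaSubgraph
  theta₃ {u} {v} ps qs rs ps≢[] qs≢[] rs≢[] ch₁ ch₂ ch₃ bound = record
    { u = u ; v = v ; interior = paths ; interior≢[] = nonempty ; chain = chains ; distinct = bound }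
    where
    paths : Fin 3 → List (Fin n)
    paths 0F = ps
    paths 1F = qs
    paths 2F = rs
    nonempty : ∀ k → paths k ≢ []
    nonempty 0F = ps≢[]
    nonempty 1F = qs≢[]
    nonempty 2F = rs≢[]
    chains : ∀ k → Chain G u (paths k) v
    chains 0F = ch₁
    chains 1F = ch₂
    chains 2F = ch₃

  module _ (T : ThetaSubgraph) where
    open ThetaSubgraph T

    distinct-at : ∀ {k k' c} → k ≢ k' → k ≢ c → k' ≢ c → ∀ z →
      δ z u + δ z v + (multiplicity z (interior k) + multiplicity z (interior k') + multiplicity z (interior c)) ≤ 1
    distinct-at k≢k' k≢c k'≢c z =
      subst (λ s → δ z u + δ z v + s ≤ 1)
        (sym (∑₃-permute (λ j → multiplicity z (interior j)) k≢k' k≢c k'≢c)) (distinct z)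

    size-at : ∀ {k k' c} → k ≢ k' → k ≢ c → k' ≢ c →
      length (interior k) + length (interior k') + length (interior c) ≡ size T
    size-at = ∑₃-permute (λ j → length (interior j))

    chain-at : ∀ {k xs} → interior k ≡ xs → Chain G u xs v
    chain-at {k} eq = subst (λ xs → Chain G u xs v) eq (chain k)

    multiplicity-at : ∀ {k} as {x} bs → interior k ≡ as ++ x ∷ bs → ∀ z →
      multiplicity z (interior k) ≡ multiplicity z as + (δ z x + multiplicity z bs)
    multiplicity-at as {x} bs eq z = trans (cong (multiplicity z) eq) (multiplicity-++ z as (x ∷ bs))

    length-at : ∀ {k} as {x} bs → interior k ≡ as ++ x ∷ bs →
      length (interior k) ≡ length as + suc (length bs)
    length-at as bs eq = trans (cong length eq) (length-++ as)

    rebuild : ∀ {k k' c} → k ≢ k' → k ≢ c → k' ≢ c →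
      ∀ {u' v'} ps qs rs → ps ≢ [] → qs ≢ [] → rs ≢ [] →
      Chain G u' ps v' → Chain G u' qs v' → Chain G u' rs v' →
      (∀ z → δ z u' + δ z v' + (multiplicity z ps + multiplicity z qs + multiplicity z rs) ≤
             δ z u + δ z v +
               (multiplicity z (interior k) + multiplicity z (interior k') + multiplicity z (interior c))) →
      length ps + length qs + length rs < length (interior k) + length (interior k') + length (interior c) →
      Shorter T
    rebuild k≢k' k≢c k'≢c ps qs rs ps≢[] qs≢[] rs≢[] ch₁ ch₂ ch₃ fewer shorter =
      theta₃ ps qs rs ps≢[] qs≢[] rs≢[] ch₁ ch₂ ch₃
        (λ z → ≤-trans (fewer z) (distinct-at k≢k' k≢c k'≢c z)) ,
      subst (length ps + length qs + length rs <_) (size-at k≢k' k≢c k'≢c) shorter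

    replace-interior : ∀ k xs → xs ≢ [] → Chain G u xs v →
      xs ⊑ interior k → length xs < length (interior k) → Shorter T
    replace-interior k xs xs≢[] ch xs⊑ xs< with another k
    ... | k' , k≢k' with third k≢k'
    ... | c , k≢c , k'≢c =
      rebuild k≢k' k≢c k'≢c xs (interior k') (interior c) xs≢[] (interior≢[] k') (interior≢[] c)
        ch (chain k') (chain c)
        (λ z → +-monoʳ-≤ (δ z u + δ z v) (+-monoˡ-≤ _ (+-monoˡ-≤ _ (⊑⇒≤ xs⊑ z))))
        (+-monoˡ-< (length (interior c)) (+-monoˡ-< (length (interior k')) xs<))

    shortcut-inside : ∀ k as {x ms y} bs → interior k ≡ as ++ x ∷ ms ++ y ∷ bs → ms ≢ [] →
      Adj G x y → Shorter T
    shortcut-inside k as {x} {ms} {y} bs eq ms≢[] x~y =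
      replace-interior k (as ++ x ∷ y ∷ bs) (++-∷≢[] as)
        (chain-++⁺ G as (proj₁ split) (x~y , proj₂ (chain-++⁻ G ms (proj₂ split))))
        (subst (as ++ x ∷ y ∷ bs ⊑_) (sym eq) (⊑-++⁺ˡ as (⊑-∷⁺ x (⊑-++ʳ ms))))
        (subst (length (as ++ x ∷ y ∷ bs) <_) (cong length (sym eq))
          (length-++ˡ-< as (s≤s (length-++ʳ-< (y ∷ bs) ms≢[]))))
      where
      split = chain-++⁻ G as (chain-at eq)

    shortcut-u : ∀ k as {x} bs → interior k ≡ as ++ x ∷ bs → as ≢ [] → Adj G u x → Shorter T
    shortcut-u k as {x} bs eq as≢[] u~x =
      replace-interior k (x ∷ bs) (λ ()) (u~x , proj₂ (chain-++⁻ G as (chain-at eq)))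
        (subst (x ∷ bs ⊑_) (sym eq) (⊑-++ʳ as))
        (subst (length (x ∷ bs) <_) (cong length (sym eq)) (length-++ʳ-< (x ∷ bs) as≢[]))

    shortcut-v : ∀ k as {x} bs → interior k ≡ as ++ x ∷ bs → bs ≢ [] → Adj G x v → Shorter T
    shortcut-v k as {x} bs eq bs≢[] x~v =
      replace-interior k (as ++ x ∷ []) (++-∷≢[] as)
        (chain-++⁺ G as (proj₁ (chain-++⁻ G as (chain-at eq))) x~v)
        (subst (as ++ x ∷ [] ⊑_) (sym eq) (⊑-++⁺ˡ as (⊑-∷⁺ x ([]⊑ bs))))
        (subst (length (as ++ x ∷ []) <_) (cong length (sym eq))
          (length-++ˡ-< as (s≤s (≢[]⇒0<length bs≢[]))))

    -- The chord x–y yields a theta subgraph with ends x and v that bypasses the vertices of path k' before y.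
    reroot-at-chord : ∀ {k k'} → k ≢ k' → ∀ as {x} as' bs {y} bs' →
      interior k ≡ as ++ x ∷ as' → interior k' ≡ bs ++ y ∷ bs' → as' ≢ [] → bs ≢ [] →
      Adj G x y → Shorter T
    reroot-at-chord {k} {k'} k≢k' as {x} as' bs {y} bs' eq eq' as'≢[] bs≢[] x~y with third k≢k'
    ... | c , k≢c , k'≢c =
      rebuild k≢k' k≢c k'≢c as' (y ∷ bs') (reverse as ++ u ∷ interior c)
        as'≢[] (λ ()) (++-∷≢[] (reverse as))
        (proj₂ split) (x~y , proj₂ split')
        (chain-++⁺ G (reverse as) (chain-reverse G as (proj₁ split)) (chain c))
        fewer shorter
      where
      split = chain-++⁻ G as (chain-at eq)
      split' = chain-++⁻ G bs (chain-at eq')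
      rearrange : ∀ u v x y a a' b b' c →
        x + v + (a' + (y + b') + (a + (u + c))) + b ≡ u + v + (a + (x + a') + (b + (y + b')) + c)
      rearrange = solve-∀
      fewer : ∀ z → δ z x + δ z v +
        (multiplicity z as' + (δ z y + multiplicity z bs') + multiplicity z (reverse as ++ u ∷ interior c)) ≤
        δ z u + δ z v + (multiplicity z (interior k) + multiplicity z (interior k') + multiplicity z (interior c))
      fewer z = begin
        δ z x + δ z v +
          (multiplicity z as' + (δ z y + multiplicity z bs') + multiplicity z (reverse as ++ u ∷ interior c))
          ≡⟨ cong (λ t → δ z x + δ z v + (multiplicity z as' + (δ z y + multiplicity z bs') + t))
               (trans (multiplicity-++ z (reverse as) _) (cong (_+ _) (multiplicity-reverse z as))) ⟩
        _ ≤⟨ m≤m+n _ (multiplicity z bs) ⟩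
        _ ≡⟨ rearrange (δ z u) (δ z v) (δ z x) (δ z y) (multiplicity z as) (multiplicity z as')
               (multiplicity z bs) (multiplicity z bs') (multiplicity z (interior c)) ⟩
        _ ≡⟨ cong (λ t → δ z u + δ z v + t) (sym (cong₂ (λ p q → p + q + multiplicity z (interior c))
               (multiplicity-at as as' eq z) (multiplicity-at bs bs' eq' z))) ⟩
        δ z u + δ z v + (multiplicity z (interior k) + multiplicity z (interior k') + multiplicity z (interior c)) ∎
        where open ≤-Reasoning
      rearrange-lengths : ∀ a a' b b' c → a' + suc b' + (a + suc c) + b ≡ a + suc a' + (b + suc b') + c
      rearrange-lengths = solve-∀
      shorter : length as' + length (y ∷ bs') + length (reverse as ++ u ∷ interior c) <
                length (interior k) + length (interior k') + length (interior c)
      shorter = begin-strict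
        length as' + suc (length bs') + length (reverse as ++ u ∷ interior c)
          ≡⟨ cong (length as' + suc (length bs') +_)
               (trans (length-++ (reverse as)) (cong (_+ _) (length-reverse as))) ⟩
        _ <⟨ m<m+n _ (≢[]⇒0<length bs≢[]) ⟩
        _ ≡⟨ rearrange-lengths (length as) (length as') (length bs) (length bs') (length (interior c)) ⟩
        _ ≡⟨ sym (cong₂ (λ p q → p + q + length (interior c)) (length-at as as' eq) (length-at bs bs' eq')) ⟩
        length (interior k) + length (interior k') + length (interior c) ∎
        where open ≤-Reasoning

    -- Two singleton paths {x}, {z} and a segment x … z of the third path form a theta subgraph with ends x and z.
    reroot-at-singletons : ∀ {k k' c} → k ≢ k' → k ≢ c → k' ≢ c → ∀ {x z} bs seg bs' →
      interior k ≡ x ∷ [] → interior c ≡ z ∷ [] → interior k' ≡ bs ++ seg ++ bs' →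
      bs ≢ [] → seg ≢ [] → Chain G x seg z → Shorter T
    reroot-at-singletons {k} {k'} {c} k≢k' k≢c k'≢c {x} {z} bs seg bs' eq eqc eq' bs≢[] seg≢[] ch =
      rebuild k≢k' k≢c k'≢c (u ∷ []) (v ∷ []) seg (λ ()) (λ ()) seg≢[]
        (Adj-sym G (proj₁ via-x) , proj₁ via-z) (proj₂ via-x , Adj-sym G (proj₂ via-z)) ch fewer shorter
      where
      via-x = chain-at eq
      via-z = chain-at eqc
      rearrange : ∀ u v x z b s b' →
        x + z + (u + 0 + (v + 0) + s) + (b + b') ≡ u + v + (x + 0 + (b + (s + b')) + (z + 0))
      rearrange = solve-∀
      fewer : ∀ w → δ w x + δ w z + (δ w u + 0 + (δ w v + 0) + multiplicity w seg) ≤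
        δ w u + δ w v + (multiplicity w (interior k) + multiplicity w (interior k') + multiplicity w (interior c))
      fewer w = begin
        δ w x + δ w z + (δ w u + 0 + (δ w v + 0) + multiplicity w seg)
          ≤⟨ m≤m+n _ (multiplicity w bs + multiplicity w bs') ⟩
        _ ≡⟨ rearrange (δ w u) (δ w v) (δ w x) (δ w z)
               (multiplicity w bs) (multiplicity w seg) (multiplicity w bs') ⟩
        _ ≡⟨ cong (λ t → δ w u + δ w v + t)
               (sym (cong₂ _+_ (cong₂ _+_ (cong (multiplicity w) eq) in-k') (cong (multiplicity w) eqc))) ⟩
        δ w u + δ w v + (multiplicity w (interior k) + multiplicity w (interior k') + multiplicity w (interior c)) ∎
        where
        open ≤-Reasoning
        in-k' : multiplicity w (interior k') ≡ multiplicity w bs + (multiplicity w seg + multiplicity w bs')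
        in-k' = trans (cong (multiplicity w) eq')
          (trans (multiplicity-++ w bs _) (cong (_ +_) (multiplicity-++ w seg bs')))
      rearrange-lengths : ∀ b s b' → 2 + s + (b + b') ≡ 1 + (b + (s + b')) + 1
      rearrange-lengths = solve-∀
      shorter : 1 + 1 + length seg < length (interior k) + length (interior k') + length (interior c)
      shorter = begin-strict
        1 + 1 + length seg
          <⟨ m<m+n _ (+-mono-<-≤ (≢[]⇒0<length bs≢[]) z≤n) ⟩
        2 + length seg + (length bs + length bs')
          ≡⟨ rearrange-lengths (length bs) (length seg) (length bs') ⟩
        1 + (length bs + (length seg + length bs')) + 1
          ≡⟨ sym (cong₂ _+_ (cong₂ _+_ (cong length eq) in-k') (cong length eqc)) ⟩
        length (interior k) + length (interior k') + length (interior c) ∎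
        where
        open ≤-Reasoning
        in-k' : length (interior k') ≡ length bs + (length seg + length bs')
        in-k' = trans (cong length eq') (trans (length-++ bs) (cong (_ +_) (length-++ seg)))

    -- x is the only interior vertex of path k and y an interior vertex of path k' other than its first;
    -- together with an edge x–y, x is the hub of a wheel whose rim is formed by the other two paths.
    record HubChord (k k' : Fin 3) (x y : Fin n) : Set where
      field
        before after : List (Fin n)
        interior-k : interior k ≡ x ∷ []
        interior-k' : interior k' ≡ before ++ y ∷ after
        before≢[] : before ≢ []

    cross-chord : TriangleFree G → ∀ {k k'} → k ≢ k' → ∀ as {x} as' bs {y} bs' →
      interior k ≡ as ++ x ∷ as' → interior k' ≡ bs ++ y ∷ bs' → Adj G x y →
      Shorter T ⊎ HubChord k k' x y ⊎ HubChord k' k y x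
    cross-chord _ k≢k' as@(_ ∷ _) as' bs bs'@(_ ∷ _) eq eq' x~y =
      inj₁ (reroot-at-chord (λ k'≡k → k≢k' (sym k'≡k)) bs bs' as as' eq' eq (λ ()) (λ ()) (Adj-sym G x~y))
    cross-chord _ k≢k' as as'@(_ ∷ _) bs@(_ ∷ _) bs' eq eq' x~y =
      inj₁ (reroot-at-chord k≢k' as as' bs bs' eq eq' (λ ()) (λ ()) x~y)
    cross-chord tf _ as [] bs [] eq eq' x~y =
      ⊥-elim (triangle G tf x~y (proj₂ (chain-++⁻ G bs (chain-at eq')))
                                (proj₂ (chain-++⁻ G as (chain-at eq))))
    cross-chord tf _ [] as' [] bs' eq eq' x~y =
      ⊥-elim (triangle G tf (proj₁ (chain-at eq)) x~y (proj₁ (chain-at eq')))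
    cross-chord _ _ [] [] bs@(_ ∷ _) bs'@(_ ∷ _) eq eq' _ =
      inj₂ (inj₁ (record { before = bs ; after = bs' ; interior-k = eq ; interior-k' = eq'
                         ; before≢[] = λ () }))
    cross-chord _ _ as@(_ ∷ _) as'@(_ ∷ _) [] [] eq eq' _ =
      inj₂ (inj₂ (record { before = as ; after = as' ; interior-k = eq' ; interior-k' = eq
                         ; before≢[] = λ () }))

module _ {n : ℕ} (G : Graph n) where

  Chordless : List (Fin n) → Set
  Chordless cycle = ∀ {s t} → s ∈ cycle → t ∈ cycle → Adj G s t →
    CyclicallyConsecutive s t cycle ⊎ CyclicallyConsecutive t s cycle

  record ThreeNeighbours (x : Fin n) (cycle : List (Fin n)) : Set where
    field
      {p q r} : Fin n
      p≢q : p ≢ q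
      q≢r : q ≢ r
      p≢r : p ≢ r
      p∈ : p ∈ cycle
      q∈ : q ∈ cycle
      r∈ : r ∈ cycle
      x~p : Adj G x p
      x~q : Adj G x q
      x~r : Adj G x r

  induced-wheel : ∀ x a rs → Distinct (x ∷ a ∷ rs) → Chain G a rs a → 2 ≤ length rs →
    Chordless (a ∷ rs) → ThreeNeighbours x (a ∷ rs) → HasInducedWheel G
  induced-wheel x a rs distinct closed long chordless spokes =
    length cycle , s≤s long , S , three , embed , injective , λ s t → forward , backward s t
    where
    cycle = a ∷ rs
    cycle-distinct = Distinct-tail {x = x} {xs = cycle} distinct
    m = length cycle
    S : Fin m → Bool
    S i = adj G x (lookup cycle i)

    embed : WheelV m → Fin n
    embed hub = x
    embed (rim i) = lookup cycle i

    injective : ∀ s t → embed s ≡ embed t → s ≡ t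
    injective hub hub _ = refl
    injective hub (rim i) eq = ⊥-elim (Distinct-head distinct (subst (_∈ cycle) (sym eq) (∈-lookup i)))
    injective (rim i) hub eq = ⊥-elim (Distinct-head distinct (subst (_∈ cycle) eq (∈-lookup i)))
    injective (rim i) (rim j) eq = cong rim (lookup-injective cycle cycle-distinct i j eq)

    forward-directed : ∀ {s t} → WheelD m S s t → Adj G (embed s) (embed t)
    forward-directed (cyc i j i→j) = closed-chain-cyclic G rs closed i j i→j
    forward-directed (spoke i hub~i) = hub~i

    forward : ∀ {s t} → WheelAdj m S s t → Adj G (embed s) (embed t)
    forward (inj₁ d) = forward-directed d
    forward (inj₂ d) = Adj-sym G (forward-directed d)

    backward : ∀ s t → Adj G (embed s) (embed t) → WheelAdj m S s t
    backward hub hub hub~hub = ⊥-elim (Adj-irrefl G hub~hub)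
    backward hub (rim i) hub~i = inj₁ (spoke i hub~i)
    backward (rim i) hub i~hub = inj₂ (spoke i (Adj-sym G i~hub))
    backward (rim i) (rim j) i~j with chordless (∈-lookup i) (∈-lookup j) i~j
    ... | inj₁ i→j = inj₁ (cyc i j (cyclically-consecutive-positions cycle cycle-distinct i j i→j))
    ... | inj₂ j→i = inj₂ (cyc j i (cyclically-consecutive-positions cycle cycle-distinct j i j→i))

    open ThreeNeighbours spokes

    distinct-indices : ∀ {s t} (s∈ : s ∈ cycle) (t∈ : t ∈ cycle) → s ≢ t → index s∈ ≢ index t∈
    distinct-indices s∈ t∈ s≢t same =
      s≢t (trans (lookup-index s∈) (trans (cong (lookup cycle) same) (sym (lookup-index t∈))))

    spoke-at : ∀ {s} (s∈ : s ∈ cycle) → Adj G x s → S (index s∈) ≡ true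
    spoke-at s∈ x~s = subst (Adj G x) (lookup-index s∈) x~s

    three : AtLeastThree S
    three = index p∈ , index q∈ , index r∈ , distinct-indices p∈ q∈ p≢q , distinct-indices q∈ r∈ q≢r ,
            distinct-indices p∈ r∈ p≢r , spoke-at p∈ x~p , spoke-at q∈ x~q , spoke-at r∈ x~r

module Minimal {n : ℕ} {G : Graph n} (triangle-free : TriangleFree G) (T : ThetaSubgraph G)
  (minimal : ¬ Shorter G T) where
  open ThetaSubgraph T

  ends-and-interior : ∀ k z → δ z u + δ z v + multiplicity z (interior k) ≤ 1
  ends-and-interior k z =
    ≤-trans (+-monoʳ-≤ (δ z u + δ z v) (∑₃-≥ (λ j → multiplicity z (interior j)) k)) (distinct z)

  interior-distinct : ∀ k → Distinct (interior k)
  interior-distinct k z = ≤-trans (m≤n+m _ (δ z u + δ z v)) (ends-and-interior k z)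

  interiors-disjoint : ∀ {k k' z} → k ≢ k' → z ∈ interior k → z ∈ interior k' → ⊥
  interiors-disjoint {z = z} k≢k' z∈ z∈' = ∈-both⇒multiplicities≰1 z∈ z∈'
    (≤-trans (∑₃-≥₂ (λ j → multiplicity z (interior j)) k≢k')
             (≤-trans (m≤n+m _ (δ z u + δ z v)) (distinct z)))

  u∉interior : ∀ k → u ∉ interior k
  u∉interior k u∈ = 1+n≰n (≤-trans (+-mono-≤ (≤-reflexive (sym (δ-refl u))) (∈⇒1≤multiplicity u∈))
    (≤-trans (+-monoˡ-≤ _ (m≤m+n (δ u u) (δ u v))) (ends-and-interior k u)))

  v∉interior : ∀ k → v ∉ interior k
  v∉interior k v∈ = 1+n≰n (≤-trans (+-mono-≤ (≤-reflexive (sym (δ-refl v))) (∈⇒1≤multiplicity v∈))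
    (≤-trans (+-monoˡ-≤ _ (m≤n+m (δ v v) (δ v u))) (ends-and-interior k v)))

  u≢v : u ≢ v
  u≢v refl = 1+n≰n (≤-trans (≤-reflexive (cong₂ _+_ (sym (δ-refl u)) (sym (δ-refl u))))
                             (≤-trans (m≤m+n _ _) (distinct u)))

  chord-inside : ∀ k {s t} → s ∈ interior k → t ∈ interior k → Adj G s t →
    Consecutive s t (interior k) ⊎ Consecutive t s (interior k)
  chord-inside k {s} {t} s∈ t∈ s~t with s F.≟ t
  ... | yes refl = ⊥-elim (Adj-irrefl G s~t)
  ... | no s≢t with ∈-ordered (interior k) s∈ t∈ s≢t
  ... | inj₁ (as , [] , bs , eq) = inj₁ (as , bs , eq)
  ... | inj₁ (as , ms@(_ ∷ _) , bs , eq) = ⊥-elim (minimal (shortcut-inside G T k as {ms = ms} bs eq (λ ()) s~t))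
  ... | inj₂ (as , [] , bs , eq) = inj₂ (as , bs , eq)
  ... | inj₂ (as , ms@(_ ∷ _) , bs , eq) =
    ⊥-elim (minimal (shortcut-inside G T k as {ms = ms} bs eq (λ ()) (Adj-sym G s~t)))

  chord-u : ∀ k {x} → x ∈ interior k → Adj G u x → ∃ λ bs → interior k ≡ x ∷ bs
  chord-u k x∈ u~x with ∈-∃++ x∈
  ... | [] , bs , eq = bs , eq
  ... | as@(_ ∷ _) , bs , eq = ⊥-elim (minimal (shortcut-u G T k as bs eq (λ ()) u~x))

  chord-v : ∀ k {x} → x ∈ interior k → Adj G x v → ∃ λ as → interior k ≡ as ++ x ∷ []
  chord-v k x∈ x~v with ∈-∃++ x∈
  ... | as , [] , eq = as , eq
  ... | as , bs@(_ ∷ _) , eq = ⊥-elim (minimal (shortcut-v G T k as bs eq (λ ()) x~v))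

  chord-across : ∀ {k k'} → k ≢ k' → ∀ {x y} → x ∈ interior k → y ∈ interior k' → Adj G x y →
    HubChord G T k k' x y ⊎ HubChord G T k' k y x
  chord-across k≢k' x∈ y∈ x~y with ∈-∃++ x∈ | ∈-∃++ y∈
  ... | as , as' , eq | bs , bs' , eq' with cross-chord G T triangle-free k≢k' as as' bs bs' eq eq' x~y
  ... | inj₁ shorter = ⊥-elim (minimal shorter)
  ... | inj₂ hub-chord = hub-chord

  NoHubChords : Set
  NoHubChords = ∀ {k k' x y} → k ≢ k' → HubChord G T k k' x y → ¬ Adj G x y

  private
    nonempty-form : ∀ k → ∃₂ λ x xs → interior k ≡ x ∷ xs
    nonempty-form k with interior k | interior≢[] k
    ... | [] | interior≢[]ₖ = ⊥-elim (interior≢[]ₖ refl)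
    ... | x ∷ xs | _ = x , xs , refl

  -- The interior of the k-th path has ℓ k + 1 vertices, as in the definition of a theta.
  ℓ : Fin 3 → ℕ
  ℓ k = length (proj₁ (proj₂ (nonempty-form k)))

  private
    start : Fin 3 → Fin n
    start k = proj₁ (nonempty-form k)

    rest : Fin 3 → List (Fin n)
    rest k = proj₁ (proj₂ (nonempty-form k))

    interior≡ : ∀ k → interior k ≡ start k ∷ rest k
    interior≡ k = proj₂ (proj₂ (nonempty-form k))

    inner-distinct : ∀ k → Distinct (start k ∷ rest k)
    inner-distinct k = subst Distinct (interior≡ k) (interior-distinct k)

  vertex : ThetaV ℓ → Fin n
  vertex U = u
  vertex V = v
  vertex (P k i) = lookup (start k ∷ rest k) i

  private
    vertex-∈ : ∀ k i → vertex (P k i) ∈ interior k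
    vertex-∈ k i = subst (vertex (P k i) ∈_) (sym (interior≡ k)) (∈-lookup i)

    vertex-position : ∀ k i as bs → interior k ≡ as ++ vertex (P k i) ∷ bs → toℕ i ≡ length as
    vertex-position k i as bs eq =
      lookup-position as bs (trans (sym (interior≡ k)) eq) (inner-distinct k) i refl

    inner-chain : ∀ k → Chain G u (start k ∷ rest k) v
    inner-chain k = chain-at G T (interior≡ k)

  vertex-injective : ∀ s t → vertex s ≡ vertex t → s ≡ t
  vertex-injective U U _ = refl
  vertex-injective U V u≡v = ⊥-elim (u≢v u≡v)
  vertex-injective U (P k i) eq = ⊥-elim (u∉interior k (subst (_∈ interior k) (sym eq) (vertex-∈ k i)))
  vertex-injective V U v≡u = ⊥-elim (u≢v (sym v≡u))
  vertex-injective V V _ = refl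
  vertex-injective V (P k i) eq = ⊥-elim (v∉interior k (subst (_∈ interior k) (sym eq) (vertex-∈ k i)))
  vertex-injective (P k i) U eq = ⊥-elim (u∉interior k (subst (_∈ interior k) eq (vertex-∈ k i)))
  vertex-injective (P k i) V eq = ⊥-elim (v∉interior k (subst (_∈ interior k) eq (vertex-∈ k i)))
  vertex-injective (P k i) (P k' j) eq with k F.≟ k'
  ... | yes refl = cong (P k) (lookup-injective (start k ∷ rest k) (inner-distinct k) i j eq)
  ... | no k≢k' =
    ⊥-elim (interiors-disjoint k≢k' (vertex-∈ k i) (subst (_∈ interior k') (sym eq) (vertex-∈ k' j)))

  theta-edge : ∀ {s t} → ThetaD ℓ s t → Adj G (vertex s) (vertex t)
  theta-edge (first k) = proj₁ (inner-chain k)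
  theta-edge (along k i j j≡1+i) = chain-step G (rest k) (proj₂ (inner-chain k)) i j j≡1+i
  theta-edge (last k i i≡ℓ) = chain-last G (rest k) (proj₂ (inner-chain k)) i i≡ℓ

  private
    edge-from-u : ∀ k i → Adj G u (vertex (P k i)) → ThetaD ℓ U (P k i)
    edge-from-u k i u~x with chord-u k (vertex-∈ k i) u~x
    ... | bs , eq with toℕ-injective {j = 0F} (vertex-position k i [] bs eq)
    ... | refl = first k

    edge-to-v : ∀ k i → Adj G (vertex (P k i)) v → ThetaD ℓ (P k i) V
    edge-to-v k i x~v with chord-v k (vertex-∈ k i) x~v
    ... | as , eq = last k i (trans (vertex-position k i as [] eq) (suc-injective (begin
      suc (length as)             ≡⟨ +-comm 1 (length as) ⟩
      length as + 1               ≡⟨ sym (length-++ as) ⟩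
      length (as ++ _ ∷ [])       ≡⟨ cong length (trans (sym eq) (interior≡ k)) ⟩
      suc (ℓ k)                   ∎)))
      where open ≡-Reasoning

    edge-inside : ∀ k i j → Adj G (vertex (P k i)) (vertex (P k j)) → ThetaAdj ℓ (P k i) (P k j)
    edge-inside k i j s~t with chord-inside k (vertex-∈ k i) (vertex-∈ k j) s~t
    ... | inj₁ (as , bs , eq) = inj₁ (along k i j (consecutive-positions (start k ∷ rest k) (inner-distinct k) i j
                                                     (as , bs , trans (sym (interior≡ k)) eq)))
    ... | inj₂ (as , bs , eq) = inj₂ (along k j i (consecutive-positions (start k ∷ rest k) (inner-distinct k) j i
                                                     (as , bs , trans (sym (interior≡ k)) eq)))

  edge-classification : NoHubChords → ∀ s t → Adj G (vertex s) (vertex t) → ClosedThetaAdj ℓ s t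
  edge-classification _ U U u~u = ⊥-elim (Adj-irrefl G u~u)
  edge-classification _ U V _ = inj₁ uv
  edge-classification _ U (P k i) u~x = inj₁ (theta (edge-from-u k i u~x))
  edge-classification _ V U _ = inj₂ uv
  edge-classification _ V V v~v = ⊥-elim (Adj-irrefl G v~v)
  edge-classification _ V (P k i) v~x = inj₂ (theta (edge-to-v k i (Adj-sym G v~x)))
  edge-classification _ (P k i) U x~u = inj₂ (theta (edge-from-u k i (Adj-sym G x~u)))
  edge-classification _ (P k i) V x~v = inj₁ (theta (edge-to-v k i x~v))
  edge-classification no-hub (P k i) (P k' j) x~y with k F.≟ k'
  ... | yes refl = [ (λ d → inj₁ (theta d)) , (λ d → inj₂ (theta d)) ]′ (edge-inside k i j x~y)
  ... | no k≢k' with chord-across k≢k' (vertex-∈ k i) (vertex-∈ k' j) x~y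
  ... | inj₁ hub-chord = ⊥-elim (no-hub k≢k' hub-chord x~y)
  ... | inj₂ hub-chord = ⊥-elim (no-hub (λ k'≡k → k≢k' (sym k'≡k)) hub-chord (Adj-sym G x~y))

  induced-closed-theta : Adj G u v → HasInducedClosedTheta G
  induced-closed-theta u~v = ℓ , vertex , vertex-injective , λ s t → forward , edge-classification no-hub s t
    where
    no-hub : NoHubChords
    no-hub _ hub-chord _ with chain-at G T (HubChord.interior-k hub-chord)
    ... | u~x , x~v = triangle G triangle-free u~x x~v u~v
    forward : ∀ {s t} → ClosedThetaAdj ℓ s t → Adj G (vertex s) (vertex t)
    forward (inj₁ (theta d)) = theta-edge d
    forward (inj₁ uv) = u~v
    forward (inj₂ (theta d)) = Adj-sym G (theta-edge d)
    forward (inj₂ uv) = Adj-sym G u~v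

  induced-theta : NoHubChords → ¬ Adj G u v → HasInducedTheta G
  induced-theta no-hub u≁v = ℓ , vertex , vertex-injective , λ s t → forward , backward s t
    where
    forward : ∀ {s t} → ThetaAdj ℓ s t → Adj G (vertex s) (vertex t)
    forward (inj₁ d) = theta-edge d
    forward (inj₂ d) = Adj-sym G (theta-edge d)
    backward : ∀ s t → Adj G (vertex s) (vertex t) → ThetaAdj ℓ s t
    backward s t s~t with edge-classification no-hub s t s~t
    ... | inj₁ (theta d) = inj₁ d
    ... | inj₁ uv = ⊥-elim (u≁v s~t)
    ... | inj₂ (theta d) = inj₂ d
    ... | inj₂ uv = ⊥-elim (u≁v (Adj-sym G s~t))

  private
    segment : ∀ {k} pre {a} mid {b} post → interior k ≡ pre ++ a ∷ mid ++ b ∷ post →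
      interior k ≡ pre ++ (a ∷ mid ++ b ∷ []) ++ post × Chain G a mid b
    segment {k} pre {a} mid {b} post eq =
      trans eq (cong (λ l → pre ++ a ∷ l) (sym (++-assoc mid (b ∷ []) post))) ,
      proj₁ (chain-++⁻ G mid (proj₂ (chain-++⁻ G pre (chain-at G T eq))))

    singleton≢long : ∀ {k s y} before after → before ≢ [] →
      interior k ≡ s ∷ [] → interior k ≡ before ++ y ∷ after → ⊥
    singleton≢long [] _ before≢[] _ _ = before≢[] refl
    singleton≢long (b ∷ bs) after _ eq eq' = ++-∷≢[] bs (sym (∷-injectiveʳ (trans (sym eq) eq')))

  module HubChordWheel {k k' x y} (k≢k' : k ≢ k') (hub-chord : HubChord G T k k' x y) (x~y : Adj G x y) where

    open HubChord hub-chord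

    private
      c : Fin 3
      c = proj₁ (third k≢k')

      k≢c : k ≢ c
      k≢c = proj₁ (proj₂ (third k≢k'))

      k'≢c : k' ≢ c
      k'≢c = proj₂ (proj₂ (third k≢k'))

      u~x : Adj G u x
      u~x = proj₁ (chain-at G T interior-k)

      x~v : Adj G x v
      x~v = proj₂ (chain-at G T interior-k)

      y∈ : y ∈ interior k'
      y∈ = subst (y ∈_) (sym interior-k') (∈-++⁺ʳ before (here refl))

    around : List (Fin n)
    around = interior k' ++ v ∷ reverse (interior c)

    -- Two singleton paths joined to a common path by chords would give a shorter theta subgraph.
    no-chord-k'-c : ∀ {s t} → s ∈ interior k' → t ∈ interior c → ¬ Adj G s t
    no-chord-k'-c {s} {t} s∈ t∈ s~t with chord-across k'≢c s∈ t∈ s~t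
    ... | inj₁ hub-chord' = singleton≢long before after before≢[] (HubChord.interior-k hub-chord') interior-k'
    ... | inj₂ hub-chord' = two-hubs (HubChord.interior-k hub-chord')
      where
      two-hubs : interior c ≡ t ∷ [] → ⊥
      two-hubs interior-c with y F.≟ s
      ... | yes refl = minimal (reroot-at-singletons G T k≢k' k≢c k'≢c before (y ∷ []) after
                         interior-k interior-c interior-k' before≢[] (λ ()) (x~y , s~t))
      ... | no y≢s with ∈-ordered (interior k') y∈ s∈ y≢s
      ... | inj₁ ([] , mid , post , eq) = triangle G triangle-free u~x x~y (proj₁ (chain-at G T eq))
      ... | inj₁ (pre@(_ ∷ _) , mid , post , eq) with segment pre mid post eq
      ...   | eq' , y-mid-s = minimal (reroot-at-singletons G T k≢k' k≢c k'≢c pre (y ∷ mid ++ s ∷ []) post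
                                  interior-k interior-c eq' (λ ()) (λ ()) (x~y , chain-++⁺ G mid y-mid-s s~t))
      two-hubs interior-c | no y≢s | inj₂ ([] , mid , post , eq) =
        triangle G triangle-free (proj₁ (chain-at G T interior-c)) (Adj-sym G s~t) (proj₁ (chain-at G T eq))
      two-hubs interior-c | no y≢s | inj₂ (pre@(_ ∷ _) , mid , post , eq) with segment pre mid post eq
      ... | eq' , s-mid-y =
        minimal (reroot-at-singletons G T (λ c≡k' → k'≢c (sym c≡k')) (λ c≡k → k≢c (sym c≡k))
                  (λ k'≡k → k≢k' (sym k'≡k)) pre (s ∷ mid ++ y ∷ []) post
                  interior-c interior-k eq' (λ ()) (λ ())
                  (Adj-sym G s~t , chain-++⁺ G mid s-mid-y (Adj-sym G x~y)))

    private
      data OnCycle (s : Fin n) : Set where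
        at-u : s ≡ u → OnCycle s
        on-k' : s ∈ interior k' → OnCycle s
        at-v : s ≡ v → OnCycle s
        on-c : s ∈ interior c → OnCycle s

      on-cycle : ∀ {s} → s ∈ u ∷ around → OnCycle s
      on-cycle (here refl) = at-u refl
      on-cycle (there s∈) with ∈-++⁻ (interior k') s∈
      ... | inj₁ s∈k' = on-k' s∈k'
      ... | inj₂ (here refl) = at-v refl
      ... | inj₂ (there s∈c) = on-c (reverse⁻ s∈c)

      Rim-adjacent : Fin n → Fin n → Set
      Rim-adjacent s t = CyclicallyConsecutive s t (u ∷ around) ⊎ CyclicallyConsecutive t s (u ∷ around)

      swap : ∀ {s t} → Rim-adjacent s t → Rim-adjacent t s
      swap = [ inj₂ , inj₁ ]′

      forwards : ∀ {s t} → Consecutive s t (u ∷ around) → Rim-adjacent s t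
      forwards consecutive = inj₁ (inj₁ consecutive)

      backwards : ∀ {s t} → Consecutive t s (u ∷ around) → Rim-adjacent s t
      backwards consecutive = inj₂ (inj₁ consecutive)

      on-k'-side : ∀ {s t} → Consecutive s t (interior k' ++ v ∷ []) → Consecutive s t (u ∷ around)
      on-k'-side {s} {t} (as , bs , eq) = consecutive-++ˡ (u ∷ []) (as , bs ++ reverse (interior c) , (begin
        interior k' ++ v ∷ reverse (interior c)          ≡⟨ sym (++-assoc (interior k') (v ∷ []) _) ⟩
        (interior k' ++ v ∷ []) ++ reverse (interior c)  ≡⟨ cong (_++ reverse (interior c)) eq ⟩
        (as ++ s ∷ t ∷ bs) ++ reverse (interior c)       ≡⟨ ++-assoc as (s ∷ t ∷ bs) _ ⟩
        as ++ s ∷ t ∷ bs ++ reverse (interior c)         ∎))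
        where open ≡-Reasoning

      on-c-side : ∀ {s t} → Consecutive s t (v ∷ reverse (interior c)) → Consecutive s t (u ∷ around)
      on-c-side consecutive = consecutive-++ˡ (u ∷ []) (consecutive-++ˡ (interior k') consecutive)

      from-u-to-k' : ∀ {t} → t ∈ interior k' → Adj G u t → Rim-adjacent u t
      from-u-to-k' t∈ u~t with chord-u k' t∈ u~t
      ... | bs , eq =
        forwards ([] , bs ++ v ∷ reverse (interior c) , cong (λ l → u ∷ l ++ v ∷ reverse (interior c)) eq)

      from-u-to-c : ∀ {t} → t ∈ interior c → Adj G u t → Rim-adjacent u t
      from-u-to-c {t} t∈ u~t with chord-u c t∈ u~t
      ... | bs , eq = inj₂ (inj₂ (interior k' ++ v ∷ reverse bs , cong (u ∷_) (begin
        interior k' ++ v ∷ reverse (interior c)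
          ≡⟨ cong (λ l → interior k' ++ v ∷ reverse l) eq ⟩
        interior k' ++ v ∷ reverse (t ∷ bs)
          ≡⟨ cong (λ l → interior k' ++ v ∷ l) (unfold-reverse t bs) ⟩
        interior k' ++ v ∷ reverse bs ++ t ∷ []
          ≡⟨ sym (++-assoc (interior k') (v ∷ reverse bs) (t ∷ [])) ⟩
        (interior k' ++ v ∷ reverse bs) ++ t ∷ [] ∎)))
        where open ≡-Reasoning

      from-k'-to-v : ∀ {s} → s ∈ interior k' → Adj G s v → Rim-adjacent s v
      from-k'-to-v s∈ s~v with chord-v k' s∈ s~v
      ... | as , eq = forwards (on-k'-side (as , [] , trans (cong (_++ v ∷ []) eq) (++-assoc as _ _)))

      from-v-to-c : ∀ {t} → t ∈ interior c → Adj G v t → Rim-adjacent v t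
      from-v-to-c {t} t∈ v~t with chord-v c t∈ (Adj-sym G v~t)
      ... | as , eq =
        forwards (on-c-side ([] , reverse as , cong (v ∷_) (trans (cong reverse eq) (reverse-++ as (t ∷ [])))))

      inside-k' : ∀ {s t} → s ∈ interior k' → t ∈ interior k' → Adj G s t → Rim-adjacent s t
      inside-k' s∈ t∈ s~t with chord-inside k' s∈ t∈ s~t
      ... | inj₁ consecutive = forwards (on-k'-side (consecutive-++ʳ (v ∷ []) consecutive))
      ... | inj₂ consecutive = backwards (on-k'-side (consecutive-++ʳ (v ∷ []) consecutive))

      inside-c : ∀ {s t} → s ∈ interior c → t ∈ interior c → Adj G s t → Rim-adjacent s t
      inside-c s∈ t∈ s~t with chord-inside c s∈ t∈ s~t
      ... | inj₁ consecutive = backwards (on-c-side (consecutive-++ˡ (v ∷ []) (consecutive-reverse consecutive)))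
      ... | inj₂ consecutive = forwards (on-c-side (consecutive-++ˡ (v ∷ []) (consecutive-reverse consecutive)))

      u≁v : ¬ Adj G u v
      u≁v = triangle G triangle-free u~x x~v

      rim-chord : ∀ {s t} → OnCycle s → OnCycle t → Adj G s t → Rim-adjacent s t
      rim-chord (at-u refl) (at-u refl) u~u = ⊥-elim (Adj-irrefl G u~u)
      rim-chord (at-u refl) (on-k' t∈) u~t = from-u-to-k' t∈ u~t
      rim-chord (at-u refl) (at-v refl) u~v = ⊥-elim (u≁v u~v)
      rim-chord (at-u refl) (on-c t∈) u~t = from-u-to-c t∈ u~t
      rim-chord (on-k' s∈) (at-u refl) s~u = swap (from-u-to-k' s∈ (Adj-sym G s~u))
      rim-chord (on-k' s∈) (on-k' t∈) s~t = inside-k' s∈ t∈ s~t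
      rim-chord (on-k' s∈) (at-v refl) s~v = from-k'-to-v s∈ s~v
      rim-chord (on-k' s∈) (on-c t∈) s~t = ⊥-elim (no-chord-k'-c s∈ t∈ s~t)
      rim-chord (at-v refl) (at-u refl) v~u = ⊥-elim (u≁v (Adj-sym G v~u))
      rim-chord (at-v refl) (on-k' t∈) v~t = swap (from-k'-to-v t∈ (Adj-sym G v~t))
      rim-chord (at-v refl) (at-v refl) v~v = ⊥-elim (Adj-irrefl G v~v)
      rim-chord (at-v refl) (on-c t∈) v~t = from-v-to-c t∈ v~t
      rim-chord (on-c s∈) (at-u refl) s~u = swap (from-u-to-c s∈ (Adj-sym G s~u))
      rim-chord (on-c s∈) (on-k' t∈) s~t = ⊥-elim (no-chord-k'-c t∈ s∈ (Adj-sym G s~t))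
      rim-chord (on-c s∈) (at-v refl) s~v = swap (from-v-to-c s∈ (Adj-sym G s~v))
      rim-chord (on-c s∈) (on-c t∈) s~t = inside-c s∈ t∈ s~t

    chordless : Chordless G (u ∷ around)
    chordless s∈ t∈ = rim-chord (on-cycle s∈) (on-cycle t∈)

    wheel-distinct : Distinct (x ∷ u ∷ around)
    wheel-distinct z = begin
      δ z x + (δ z u + multiplicity z around)
        ≡⟨ cong (λ m → δ z x + (δ z u + m)) (trans (multiplicity-++ z (interior k') _)
             (cong (λ m → multiplicity z (interior k') + (δ z v + m)) (multiplicity-reverse z (interior c)))) ⟩
      δ z x + (δ z u + (multiplicity z (interior k') + (δ z v + multiplicity z (interior c))))
        ≡⟨ rearrange (δ z u) (δ z v) (δ z x) (multiplicity z (interior k')) (multiplicity z (interior c)) ⟩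
      δ z u + δ z v + (δ z x + 0 + multiplicity z (interior k') + multiplicity z (interior c))
        ≡⟨ cong (λ m → δ z u + δ z v + (m + multiplicity z (interior k') + multiplicity z (interior c)))
             (cong (multiplicity z) (sym interior-k)) ⟩
      δ z u + δ z v + (multiplicity z (interior k) + multiplicity z (interior k') + multiplicity z (interior c))
        ≤⟨ distinct-at G T k≢k' k≢c k'≢c z ⟩
      1 ∎
      where
      open ≤-Reasoning
      rearrange : ∀ u v x a c → x + (u + (a + (v + c))) ≡ u + v + (x + 0 + a + c)
      rearrange = solve-∀

    spokes : ThreeNeighbours G x (u ∷ around)
    spokes = record
      { p≢q = λ u≡y → u∉interior k' (subst (_∈ interior k') (sym u≡y) y∈)
      ; q≢r = λ y≡v → v∉interior k' (subst (_∈ interior k') y≡v y∈)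
      ; p≢r = u≢v
      ; p∈ = here refl
      ; q∈ = there (∈-++⁺ˡ y∈)
      ; r∈ = there (∈-++⁺ʳ (interior k') (here refl))
      ; x~p = Adj-sym G u~x
      ; x~q = x~y
      ; x~r = x~v
      }

    wheel : HasInducedWheel G
    wheel = induced-wheel G x u around wheel-distinct
      (chain-++⁺ G (interior k') (chain k') (chain-reverse G (interior c) (chain c)))
      (≤-trans (+-mono-≤ (≢[]⇒0<length (interior≢[] k')) (s≤s z≤n))
               (≤-reflexive (sym (length-++ (interior k')))))
      chordless spokes

  theta-or-closed-theta : ¬ HasInducedWheel G → HasInducedTheta G ⊎ HasInducedClosedTheta G
  theta-or-closed-theta no-wheel with adj G u v Bool.≟ true
  ... | yes u~v = inj₂ (induced-closed-theta u~v)
  ... | no u≁v =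
    inj₁ (induced-theta (λ k≢k' hub-chord x~y → no-wheel (HubChordWheel.wheel k≢k' hub-chord x~y)) u≁v)

Distinct⇒length≤ : ∀ {n} (xs : List (Fin n)) → Distinct xs → length xs ≤ n
Distinct⇒length≤ xs d = injective⇒≤ (λ {i} {j} → lookup-injective xs d i j)

two-vertices : ∀ {m} → 2 ≤ m → ∃₂ λ (a b : Fin m) → a ≢ b
two-vertices (s≤s (s≤s _)) = F.zero , F.suc F.zero , λ ()

module _ {n : ℕ} (G : Graph n) where

  -- A cycle through distinct vertices; with two vertices it is a doubled edge, which is where the growth starts.
  record Cycle : Set where
    field
      base : Fin n
      rest : List (Fin n)
      rest≢[] : rest ≢ []
      closed : Chain G base rest base
      distinct : Distinct (base ∷ rest)

    vertices : List (Fin n)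
    vertices = base ∷ rest

  open Cycle

  Longer : Cycle → Set
  Longer C = ∃ λ C' → length (vertices C) < length (vertices C')

  rotate : ∀ (C : Cycle) {s} → s ∈ vertices C →
    ∃ λ C' → base C' ≡ s × length (vertices C') ≡ length (vertices C) ×
             (∀ {z} → z ∈ vertices C' → z ∈ vertices C) ×
             (∀ {z} → z ∈ vertices C → z ≢ s → z ∈ rest C')
  rotate C (here refl) =
    C , refl , refl , (λ z∈ → z∈) , λ { (here refl) z≢s → ⊥-elim (z≢s refl) ; (there z∈) _ → z∈ }
  rotate C {s} (there s∈) with ∈-∃++ s∈
  ... | as , bs , eq = record { base = s ; rest = bs ++ base C ∷ as ; rest≢[] = ++-∷≢[] bs
                              ; closed = chain-++⁺ G bs (proj₂ split) (proj₁ split) ; distinct = distinct' } ,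
                       refl , same-length , ⊆ , ⊇
    where
    split = chain-++⁻ G as (subst (λ xs → Chain G (base C) xs (base C)) eq (closed C))
    rearrange : ∀ s a as bs → s + (bs + (a + as)) ≡ a + (as + (s + bs))
    rearrange = solve-∀
    distinct' : Distinct (s ∷ bs ++ base C ∷ as)
    distinct' z = begin
      δ z s + multiplicity z (bs ++ base C ∷ as)
        ≡⟨ cong (δ z s +_) (multiplicity-++ z bs _) ⟩
      δ z s + (multiplicity z bs + (δ z (base C) + multiplicity z as))
        ≡⟨ rearrange (δ z s) (δ z (base C)) (multiplicity z as) (multiplicity z bs) ⟩
      δ z (base C) + (multiplicity z as + (δ z s + multiplicity z bs))
        ≡⟨ cong (δ z (base C) +_) (sym (multiplicity-++ z as _)) ⟩
      δ z (base C) + multiplicity z (as ++ s ∷ bs)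
        ≡⟨ cong (λ xs → δ z (base C) + multiplicity z xs) (sym eq) ⟩
      multiplicity z (vertices C)
        ≤⟨ distinct C z ⟩
      1 ∎
      where open ≤-Reasoning
    swap-lengths : ∀ a b → b + suc a ≡ a + suc b
    swap-lengths = solve-∀
    same-length : suc (length (bs ++ base C ∷ as)) ≡ length (vertices C)
    same-length = cong suc (begin
      length (bs ++ base C ∷ as)    ≡⟨ length-++ bs ⟩
      length bs + suc (length as)   ≡⟨ swap-lengths (length as) (length bs) ⟩
      length as + suc (length bs)   ≡⟨ sym (length-++ as) ⟩
      length (as ++ s ∷ bs)         ≡⟨ cong length (sym eq) ⟩
      length (rest C)               ∎)
      where open ≡-Reasoning
    ⊆ : ∀ {z} → z ∈ s ∷ bs ++ base C ∷ as → z ∈ vertices C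
    ⊆ z∈ = subst (λ xs → _ ∈ base C ∷ xs) (sym eq) (rotated z∈)
      where
      rotated : ∀ {z} → z ∈ s ∷ bs ++ base C ∷ as → z ∈ base C ∷ as ++ s ∷ bs
      rotated (here refl) = there (∈-++⁺ʳ as (here refl))
      rotated (there z∈) with ∈-++⁻ bs z∈
      ... | inj₁ z∈bs = there (∈-++⁺ʳ as (there z∈bs))
      ... | inj₂ (here refl) = here refl
      ... | inj₂ (there z∈as) = there (∈-++⁺ˡ z∈as)
    ⊇ : ∀ {z} → z ∈ vertices C → z ≢ s → z ∈ bs ++ base C ∷ as
    ⊇ z∈ z≢s with subst (λ xs → _ ∈ base C ∷ xs) eq z∈
    ... | here refl = ∈-++⁺ʳ bs (here refl)
    ... | there z∈' with ∈-++⁻ as z∈'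
    ...   | inj₁ z∈as = ∈-++⁺ʳ bs (there z∈as)
    ...   | inj₂ (here refl) = ⊥-elim (z≢s refl)
    ...   | inj₂ (there z∈bs) = ∈-++⁺ˡ z∈bs

  record Ear (C : Cycle) : Set where
    field
      {s t} : Fin n
      s∈ : s ∈ vertices C
      t∈ : t ∈ vertices C
      s≢t : s ≢ t
      inner : List (Fin n)
      inner≢[] : inner ≢ []
      inner-distinct : Distinct inner
      inner-chain : Chain G s inner t
      avoids : ∀ {z} → z ∈ inner → z ∉ vertices C

  module _ (C : Cycle) {t} (t∈ : t ∈ rest C) (Q : List (Fin n)) (Q≢[] : Q ≢ []) (Q-distinct : Distinct Q)
    (chain-Q : Chain G (base C) Q t) (Q-avoids : ∀ {z} → z ∈ Q → z ∉ vertices C) where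

    private
      b = base C

      joint : ∀ z → multiplicity z (vertices C) + multiplicity z Q ≤ 1
      joint z = subst (_≤ 1) (multiplicity-++ z (vertices C) Q) (Distinct-++⁺ (distinct C) Q-distinct Q-avoids z)

      cycle-multiplicity : ∀ M B → rest C ≡ M ++ t ∷ B → ∀ z →
        multiplicity z (vertices C) ≡ δ z b + (multiplicity z M + (δ z t + multiplicity z B))
      cycle-multiplicity M B eq z = cong (δ z b +_) (trans (cong (multiplicity z) eq) (multiplicity-++ z M _))

      closed-at : ∀ M B → rest C ≡ M ++ t ∷ B → Chain G b M t × Chain G t B b
      closed-at M B eq = chain-++⁻ G M (subst (λ xs → Chain G b xs b) eq (closed C))

    insert-after-base : ∀ B → rest C ≡ t ∷ B → Longer C
    insert-after-base B eq =
      record { base = b ; rest = Q ++ t ∷ B ; rest≢[] = ++-∷≢[] Q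
             ; closed = chain-++⁺ G Q chain-Q (proj₂ (closed-at [] B eq)) ; distinct = distinct' } ,
      s≤s (subst (_< length (Q ++ t ∷ B)) (cong length (sym eq)) (length-++ʳ-< (t ∷ B) Q≢[]))
      where
      rearrange : ∀ b t B Q → b + (Q + (t + B)) ≡ b + (0 + (t + B)) + Q
      rearrange = solve-∀
      distinct' : Distinct (b ∷ Q ++ t ∷ B)
      distinct' z = begin
        δ z b + multiplicity z (Q ++ t ∷ B)
          ≡⟨ cong (δ z b +_) (multiplicity-++ z Q _) ⟩
        δ z b + (multiplicity z Q + (δ z t + multiplicity z B))
          ≡⟨ rearrange (δ z b) (δ z t) (multiplicity z B) (multiplicity z Q) ⟩
        _ ≡⟨ cong (_+ multiplicity z Q) (sym (cycle-multiplicity [] B eq z)) ⟩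
        multiplicity z (vertices C) + multiplicity z Q
          ≤⟨ joint z ⟩
        1 ∎
        where open ≤-Reasoning

    insert-before-base : ∀ M → rest C ≡ M ++ t ∷ [] → Longer C
    insert-before-base M eq =
      record { base = b ; rest = M ++ t ∷ reverse Q ; rest≢[] = ++-∷≢[] M
             ; closed = chain-++⁺ G M (proj₁ (closed-at M [] eq)) (chain-reverse G Q chain-Q)
             ; distinct = distinct' } ,
      s≤s (subst (_< length (M ++ t ∷ reverse Q)) (cong length (sym eq))
             (length-++ˡ-< M (s≤s (subst (0 <_) (sym (length-reverse Q)) (≢[]⇒0<length Q≢[])))))
      where
      rearrange : ∀ b t M Q → b + (M + (t + Q)) ≡ b + (M + (t + 0)) + Q
      rearrange = solve-∀
      distinct' : Distinct (b ∷ M ++ t ∷ reverse Q)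
      distinct' z = begin
        δ z b + multiplicity z (M ++ t ∷ reverse Q)
          ≡⟨ cong (δ z b +_) (trans (multiplicity-++ z M _)
               (cong (λ m → multiplicity z M + (δ z t + m)) (multiplicity-reverse z Q))) ⟩
        δ z b + (multiplicity z M + (δ z t + multiplicity z Q))
          ≡⟨ rearrange (δ z b) (δ z t) (multiplicity z M) (multiplicity z Q) ⟩
        _ ≡⟨ cong (_+ multiplicity z Q) (sym (cycle-multiplicity M [] eq z)) ⟩
        multiplicity z (vertices C) + multiplicity z Q          ≤⟨ joint z ⟩
        1                                                       ∎
        where open ≤-Reasoning

    -- The arcs of C from its base to t, from t back to the base, and the ear are three paths between the base and t.
    cycle-with-ear : ∀ M B → rest C ≡ M ++ t ∷ B → M ≢ [] → B ≢ [] → ThetaSubgraph G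
    cycle-with-ear M B eq M≢[] B≢[] =
      theta₃ G M (reverse B) Q M≢[] (reverse≢[] B B≢[]) Q≢[]
        (proj₁ (closed-at M B eq)) (chain-reverse G B (proj₂ (closed-at M B eq))) chain-Q bound
      where
      rearrange : ∀ b t M B Q → b + t + (M + B + Q) ≡ b + (M + (t + B)) + Q
      rearrange = solve-∀
      bound : ∀ z → δ z b + δ z t + (multiplicity z M + multiplicity z (reverse B) + multiplicity z Q) ≤ 1
      bound z = begin
        δ z b + δ z t + (multiplicity z M + multiplicity z (reverse B) + multiplicity z Q)
          ≡⟨ cong (λ m → δ z b + δ z t + (multiplicity z M + m + multiplicity z Q))
               (multiplicity-reverse z B) ⟩
        δ z b + δ z t + (multiplicity z M + multiplicity z B + multiplicity z Q)
          ≡⟨ rearrange (δ z b) (δ z t) (multiplicity z M) (multiplicity z B) (multiplicity z Q) ⟩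
        _ ≡⟨ cong (_+ multiplicity z Q) (sym (cycle-multiplicity M B eq z)) ⟩
        multiplicity z (vertices C) + multiplicity z Q          ≤⟨ joint z ⟩
        1                                                       ∎
        where open ≤-Reasoning

    extend-at-base : Longer C ⊎ ThetaSubgraph G
    extend-at-base with ∈-∃++ t∈
    ... | [] , B , eq = inj₁ (insert-after-base B eq)
    ... | M , [] , eq = inj₁ (insert-before-base M eq)
    ... | M@(_ ∷ _) , B@(_ ∷ _) , eq = inj₂ (cycle-with-ear M B eq (λ ()) (λ ()))

  extend : ∀ C → Ear C → Longer C ⊎ ThetaSubgraph G
  extend C ear with rotate C (Ear.s∈ ear)
  ... | C' , refl , same-length , ⊆ , ⊇ with
    extend-at-base C' (⊇ (Ear.t∈ ear) (λ t≡s → Ear.s≢t ear (sym t≡s))) (Ear.inner ear) (Ear.inner≢[] ear)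
      (Ear.inner-distinct ear) (Ear.inner-chain ear) (λ z∈ z∈C' → Ear.avoids ear z∈ (⊆ z∈C'))
  ... | inj₁ (C'' , longer) = inj₁ (C'' , subst (_< length (vertices C'')) same-length longer)
  ... | inj₂ theta-subgraph = inj₂ theta-subgraph

  -- The ear leaves the cycle at s towards w and returns at t through G - s.
  ear : TwoConnected G → ∀ C {w} → w ∉ vertices C → Ear C
  ear (_ , connected , no-cut-vertex) C {w} w∉C
    with first-entry G (vertices C) (connected w (base C)) (here refl) w∉C
  ... | s , to-s , chain-to-s , s∈ , _ , to-s-avoids with other-than s
    where
    other-than : ∀ s → ∃ λ t₀ → t₀ ∈ vertices C × t₀ ≢ s
    other-than s with rest C | rest≢[] C | distinct C
    ... | [] | rest≢[]C | _ = ⊥-elim (rest≢[]C refl)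
    ... | r ∷ rs | _ | d with s F.≟ base C
    ...   | yes refl = r , there (here refl) , λ r≡s → Distinct-head {xs = r ∷ rs} d (here (sym r≡s))
    ...   | no s≢base = base C , here refl , λ base≡s → s≢base (sym base≡s)
  ... | t₀ , t₀∈ , t₀≢s
    with first-entry G (vertices C)
           (no-cut-vertex s w t₀ (λ w≡s → w∉C (subst (_∈ vertices C) (sym w≡s) s∈)) t₀≢s) t₀∈ w∉C
  ... | t , to-t , chain-to-t , t∈ , t≢s , to-t-avoids
    with distinct-chain G (reverse to-s ++ w ∷ to-t)
           (chain-++⁺ G (reverse to-s) (chain-reverse G to-s chain-to-s) chain-to-t) (++-∷≢[] (reverse to-s))
  ... | Q , Q-distinct , chain-Q , Q≢[] , Q⊆ = record
    { s∈ = s∈ ; t∈ = t∈ ; s≢t = λ s≡t → t≢s (sym s≡t) ; inner = Q ; inner≢[] = Q≢[]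
    ; inner-distinct = Q-distinct ; inner-chain = chain-Q ; avoids = λ z∈ → avoid (Q⊆ z∈) }
    where
    avoid : ∀ {z} → z ∈ reverse to-s ++ w ∷ to-t → z ∉ vertices C
    avoid z∈ with ∈-++⁻ (reverse to-s) z∈
    ... | inj₁ z∈to-s = to-s-avoids (reverse⁻ z∈to-s)
    ... | inj₂ (here refl) = w∉C
    ... | inj₂ (there z∈to-t) = to-t-avoids z∈to-t

  doubled-edge : TwoConnected G → Cycle
  doubled-edge (3≤n , connected , _) with two-vertices (≤-trans (n≤1+n 2) 3≤n)
  ... | a , b , a≢b with walk-first-edge G (connected a b) a≢b
  ... | y , a~y = record
    { base = a ; rest = y ∷ [] ; rest≢[] = λ () ; closed = a~y , Adj-sym G a~y
    ; distinct = Distinct-∷ {xs = y ∷ []} (λ { (here refl) → Adj-irrefl G a~y ; (there ()) })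
                   (Distinct-∷ {xs = []} (λ ()) Distinct-[]) }

  spanning-cycle⇒hamiltonian : 3 ≤ n → ∀ C → (∀ z → z ∈ vertices C) → Hamiltonian G
  spanning-cycle⇒hamiltonian 3≤n C spanning = 3≤n , σ , σ-injective , σ-surjective , σ-cyclic
    where
    L = vertices C

    length≡n : length L ≡ n
    length≡n = ≤-antisym (Distinct⇒length≤ L (distinct C)) (injective⇒≤ index-injective)
      where
      index-injective : ∀ {z w} → index (spanning z) ≡ index (spanning w) → z ≡ w
      index-injective {z} {w} same =
        trans (lookup-index (spanning z)) (trans (cong (lookup L) same) (sym (lookup-index (spanning w))))

    position : Fin n → Fin (length L)
    position = F.cast (sym length≡n)

    σ : Fin n → Fin n
    σ i = lookup L (position i)

    σ-injective : ∀ i j → σ i ≡ σ j → i ≡ j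
    σ-injective i j eq = toℕ-injective (begin
      toℕ i                ≡⟨ sym (toℕ-cast (sym length≡n) i) ⟩
      toℕ (position i)     ≡⟨ cong toℕ (lookup-injective L (distinct C) _ _ eq) ⟩
      toℕ (position j)     ≡⟨ toℕ-cast (sym length≡n) j ⟩
      toℕ j                ∎)
      where open ≡-Reasoning

    σ-surjective : ∀ z → ∃ λ i → σ i ≡ z
    σ-surjective z = F.cast length≡n (index (spanning z)) ,
      trans (cong (lookup L) (cast-involutive (sym length≡n) length≡n _)) (sym (lookup-index (spanning z)))

    σ-cyclic : ∀ i j → CycSucc i j → Adj G (σ i) (σ j)
    σ-cyclic i j i→j = closed-chain-cyclic G (rest C) (closed C) (position i) (position j) (cast-cyclic i→j)
      where
      cast-cyclic : CycSucc i j → CycSucc (position i) (position j)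
      cast-cyclic (inj₁ j≡1+i) = inj₁ (trans (toℕ-cast _ j) (trans j≡1+i (cong suc (sym (toℕ-cast _ i)))))
      cast-cyclic (inj₂ (1+i≡n , j≡0)) =
        inj₂ (trans (cong suc (toℕ-cast _ i)) (trans 1+i≡n (sym length≡n)) , trans (toℕ-cast _ j) j≡0)

  theta-subgraph-or-hamiltonian : TwoConnected G → ThetaSubgraph G ⊎ Hamiltonian G
  theta-subgraph-or-hamiltonian two-connected = grow (suc n) (doubled-edge two-connected) (s≤s (m∸n≤m n 2))
    where
    grow : ∀ m C → n ∸ length (vertices C) < m → ThetaSubgraph G ⊎ Hamiltonian G
    grow (suc m) C (s≤s missing≤m) with any? (λ z → ¬? (z ∈? vertices C))
    ... | yes (w , w∉C) with extend C (ear two-connected C w∉C)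
    ...   | inj₁ (C' , longer) =
            grow m C' (<-≤-trans (∸-monoʳ-< longer (Distinct⇒length≤ (vertices C') (distinct C'))) missing≤m)
    ...   | inj₂ theta-subgraph = inj₁ theta-subgraph
    grow (suc m) C _ | no nothing-missing =
      inj₂ (spanning-cycle⇒hamiltonian (proj₁ two-connected) C
              (λ z → decidable-stable (z ∈? vertices C) (λ z∉C → nothing-missing (z , z∉C))))

no-theta-subgraph : ∀ {n} {G : Graph n} → TriangleFree G →
  ¬ HasInducedTheta G → ¬ HasInducedClosedTheta G → ¬ HasInducedWheel G → ¬ ThetaSubgraph G
no-theta-subgraph {G = G} triangle-free no-theta no-closed-theta no-wheel T = below (suc (size G T)) T ≤-refl
  where
  below : ∀ m T → size G T < m → ⊥
  below (suc m) T (s≤s size≤m) =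
    [ no-theta , no-closed-theta ]′ (Minimal.theta-or-closed-theta triangle-free T minimal no-wheel)
    where
    minimal : ¬ Shorter G T
    minimal (T' , shorter) = below m T' (<-≤-trans shorter size≤m)

theorem10 : ∀ {n} (G : Graph n) → TriangleFree G → TwoConnected G →
    ¬ HasInducedTheta G → ¬ HasInducedClosedTheta G → ¬ HasInducedWheel G →
    Hamiltonian G
theorem10 G triangle-free two-connected no-theta no-closed-theta no-wheel
  with theta-subgraph-or-hamiltonian G two-connected
... | inj₁ T = ⊥-elim (no-theta-subgraph triangle-free no-theta no-closed-theta no-wheel T)
... | inj₂ hamiltonian = hamiltonian
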